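{- For every positive integer $m$, $[s_{111}]_{m,3}=[s_3]_{m+3,3}$.
   Context: An $(m,n)$-Dyck path is a north/east lattice path from $(0,0)$ to $(m,n)$ weakly above $y=\frac nm x$. An $(m,n)$-parking function $\pi$ is such a path $\Pi(\pi)$ whose $n$ north steps are labeled bijectively by $1,\dots,n$ (cars, in the cells just right of the north steps), increasing upward in each column; $\mathcal{PF}_{m,n}$ is the set. With $d=\gcd(m,n)$, cell $(x,y)$ (lower-left corner) has rank $my-nx+\lfloor xd/m\rfloor$. $\mathrm{ides}(\pi)=\{i:\mathrm{rank}(i)<\mathrm{rank}(i+1)\}=\{i_1<\dots<i_r\}$, $\mathrm{pides}(\pi)=(i_1,i_2-i_1,\dots,n-i_r)$. $\mathrm{area}$ = number of full cells between path and diagonal. $\lambda(P)$ = partition (English) of cells above $P$; $\mathrm{pdinv}(P)=\#\{c\in\lambda(P):\frac{\mathrm{arm}(c)}{\mathrm{leg}(c)+1}\le\frac mn<\frac{\mathrm{arm}(c)+1}{\mathrm{leg}(c)}\}$ ($x/0=\infty$); $\mathrm{tdinv}(\pi)=\#\{i<j:\mathrm{rank}(i)<\mathrm{rank}(j)<\mathrm{rank}(i)+m\}$; $\mathrm{maxdinv}(P)$ = maximum tdinv on $P$; $\mathrm{dinv}=\mathrm{tdinv}+\mathrm{pdinv}-\mathrm{maxdinv}$. With $(m,n)=(km_0,kn_0)$, $\gcd(m_0,n_0)=1$, $\mathrm{ret}(\pi)$ is the least $i\ge1$ with the path through $(im_0,in_0)$; $[r]_{1/t}=1+t^{ -1}+\dots+t^{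 -(r-1)}$. The symmetric function $\mathrm{H}_{m,n}[X;q,t]=\sum_{\pi\in\mathcal{PF}_{m,n}}[\mathrm{ret}(\pi)]_{1/t}t^{\mathrm{area}(\pi)}q^{\mathrm{dinv}(\pi)}F_{\mathrm{pides}(\pi)}[X]$ ($F_\alpha$ Gessel's fundamental quasisymmetric functions); $[s_\lambda]_{m,n}$ is the coefficient of $s_\lambda$ in its Schur expansion (equivalently in $\mathrm{Q}_{m,n}(1)$). -}

module Defs where

open import Data.Nat as ℕ using (ℕ; zero; suc; _+_; _*_; _∸_; _≤ᵇ_; _<ᵇ_; _≡ᵇ_; _⊔_)
open import Data.Nat.DivMod using (_/_)
open import Data.Nat.GCD using (gcd)
open import Data.Integer as ℤ using (ℤ; +_)
open import Data.Bool using (Bool; true; false; _∧_; _∨_; not; if_then_else_)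
open import Data.List using (List; []; _∷_; map; concatMap; length; upTo; foldr; applyUpTo)
open import Data.Nat.ListAction using (sum)
open import Data.Product using (_×_; _,_)
open import Relation.Nullary using (does)

-- total division (only ever used with a nonzero divisor)
div : ℕ → ℕ → ℕ
div a zero    = 0
div a (suc b) = a / suc b

at : List ℕ → ℕ → ℕ
at []       _       = 0
at (x ∷ xs) zero    = x
at (x ∷ xs) (suc i) = at xs i

filterB : {A : Set} → (A → Bool) → List A → List A
filterB p []       = []
filterB p (x ∷ xs) = if p x then x ∷ filterB p xs else filterB p xs

allB : {A : Set} → (A → Bool) → List A → Bool
allB p []       = true
allB p (x ∷ xs) = p x ∧ allB p xs

anyB : {A : Set} → (A → Bool) → List A → Bool
anyB p []       = false
anyB p (x ∷ xs) = p x ∨ anyB p xs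

count : {A : Set} → (A → Bool) → List A → ℕ
count p xs = length (filterB p xs)

pairsLt : ℕ → List (ℕ × ℕ)
pairsLt n = concatMap (λ j → map (λ i → (i , j)) (upTo j)) (upTo n)

seqs : ℕ → ℕ → List (List ℕ)
seqs m zero    = [] ∷ []
seqs m (suc k) = concatMap (λ x → map (x ∷_) (seqs m k)) (upTo (suc m))

insertAll : ℕ → List ℕ → List (List ℕ)
insertAll x []       = (x ∷ []) ∷ []
insertAll x (y ∷ ys) = (x ∷ y ∷ ys) ∷ map (y ∷_) (insertAll x ys)

permutations : List ℕ → List (List ℕ)
permutations []       = [] ∷ []
permutations (x ∷ xs) = concatMap (insertAll x) (permutations xs)

-- permutations of {0,…,n-1}, as the list of images (w 0 , … , w (n-1))
perms : ℕ → List (List ℕ)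
perms n = permutations (upTo n)

evenB : ℕ → Bool
evenB zero          = true
evenB (suc zero)    = false
evenB (suc (suc n)) = evenB n

sign : List ℕ → ℤ
sign w = if evenB (count (λ { (i , j) → at w j <ᵇ at w i }) (pairsLt (length w)))
         then + 1 else ℤ.- (+ 1)

ltZ : ℤ → ℤ → Bool
ltZ x y = does (x ℤ.<? y)

sumZ : List ℤ → ℤ
sumZ = foldr ℤ._+_ (+ 0)

-- A path is encoded by the list a = (a_0,…,a_{n-1}),
-- where a_y is the x-coordinate of the north step from height y to y+1.
-- It is an (m,n)-Dyck path iff a is weakly increasing and every lattice
-- point (a_y , y) lies weakly above y = (n/m) x, i.e. n*a_y ≤ m*y
-- (this forces a_0 = 0 and a_y ≤ m).

isDyck : ℕ → ℕ → List ℕ → Bool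
isDyck m n a =
  (length a ≡ᵇ n)
  ∧ allB (λ i → at a i ≤ᵇ at a (suc i)) (upTo (n ∸ 1))
  ∧ allB (λ y → n * at a y ≤ᵇ m * y) (upTo n)

dyckPaths : ℕ → ℕ → List (List ℕ)
dyckPaths m n = filterB (isDyck m n) (seqs m n)

-- The car in row y sits in cell (a_y , y).
-- A labelling is encoded by the word w = (w_0,…,w_{n-1}) where w_k is the
-- row (0-indexed) of car k+1; w is a permutation of {0,…,n-1}.
-- Cars increase upward in each column: if cars p+1 < q+1 lie in the same
-- column, then the row of car p+1 is below the row of car q+1.

colIncreasing : ℕ → List ℕ → List ℕ → Bool
colIncreasing n a w =
  allB (λ { (p , q) → not (at a (at w p) ≡ᵇ at a (at w q)) ∨ (at w p <ᵇ at w q) })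
       (pairsLt n)

labelings : ℕ → List ℕ → List (List ℕ)
labelings n a = filterB (colIncreasing n a) (perms n)

-- the set PF_{m,n}, as an explicit duplicate-free list of pairs (path , word)
PF : ℕ → ℕ → List (List ℕ × List ℕ)
PF m n = concatMap (λ a → map (a ,_) (labelings n a)) (dyckPaths m n)

cellRank : ℕ → ℕ → ℕ → ℕ → ℤ
cellRank m n x y = (+ (m * y) ℤ.- + (n * x)) ℤ.+ + div (x * gcd m n) m

rowRank : ℕ → ℕ → List ℕ → ℕ → ℤ
rowRank m n a y = cellRank m n (at a y) y

-- rank of car number k+1 (k = 0,…,n-1)
carRank : ℕ → ℕ → List ℕ → List ℕ → ℕ → ℤ
carRank m n a w k = rowRank m n a (at w k)

-- ides(π) = { i ∈ {1,…,n-1} : rank(i) < rank(i+1) }, listed increasingly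
ides : ℕ → ℕ → List ℕ → List ℕ → List ℕ
ides m n a w = filterB (λ i → ltZ (carRank m n a w (i ∸ 1)) (carRank m n a w i))
                       (applyUpTo suc (n ∸ 1))

pidesOf : ℕ → List ℕ → List ℕ
pidesOf n is = go 0 is
  where
  go : ℕ → List ℕ → List ℕ
  go prev []       = (n ∸ prev) ∷ []
  go prev (i ∷ is) = (i ∸ prev) ∷ go i is

pides : ℕ → ℕ → List ℕ → List ℕ → List ℕ
pides m n a w = pidesOf n (ides m n a w)

compSet : List ℕ → List ℕ
compSet []           = []
compSet (x ∷ [])     = []
compSet (x ∷ y ∷ r)  = x ∷ map (λ s → x + s) (compSet (y ∷ r))

-- area: in row y the full cells between path and diagonal are the cells
-- (x , y) with a_y ≤ x and n (x+1) ≤ m y; there are ⌊ m y / n ⌋ - a_y of them.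
area : ℕ → ℕ → List ℕ → ℕ
area m n a = sum (map (λ y → div (m * y) n ∸ at a y) (upTo n))

-- λ(P): the cells above the path are the cells (x , y) with x < a_y.
-- arm(x , y) = a_y - x - 1 (cells to its right in its row),
-- leg(x , y) = #{ y' < y : x < a_{y'} } (cells below it in its column).
-- The pdinv condition  arm/(leg+1) ≤ m/n < (arm+1)/leg  (x/0 = ∞) is
-- cross-multiplied (all denominators positive).
pdinvCell : ℕ → ℕ → List ℕ → ℕ → ℕ → Bool
pdinvCell m n a x y =
  let arm = at a y ∸ suc x
      leg = count (λ y' → x <ᵇ at a y') (upTo y)
  in (arm * n ≤ᵇ m * suc leg) ∧ ((leg ≡ᵇ 0) ∨ (m * leg <ᵇ n * suc arm))

pdinv : ℕ → ℕ → List ℕ → ℕ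
pdinv m n a = sum (map (λ y → count (λ x → pdinvCell m n a x y) (upTo (at a y))) (upTo n))

tdinv : ℕ → ℕ → List ℕ → List ℕ → ℕ
tdinv m n a w =
  count (λ { (p , q) → ltZ (carRank m n a w p) (carRank m n a w q)
                       ∧ ltZ (carRank m n a w q) (carRank m n a w p ℤ.+ + m) })
        (pairsLt n)

maxdinv : ℕ → ℕ → List ℕ → ℕ
maxdinv m n a = foldr _⊔_ 0 (map (tdinv m n a) (labelings n a))

dinv : ℕ → ℕ → List ℕ → List ℕ → ℤ
dinv m n a w = (+ tdinv m n a w ℤ.+ + pdinv m n a) ℤ.- + maxdinv m n a

-- ret(π): least i ≥ 1 such that the path passes through (i m₀ , i n₀),
-- where m₀ = m/d, n₀ = n/d, d = gcd m n (so i ranges over 1,…,d).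
-- The path passes through the lattice point (X , Y) (Y ≤ n) iff
-- a_{Y-1} ≤ X ≤ a_Y  (with a_{-1} := 0 and a_n := m).
through : ℕ → ℕ → List ℕ → ℕ → ℕ → Bool
through m n a X Y = (prev Y ≤ᵇ X) ∧ (X ≤ᵇ (if Y <ᵇ n then at a Y else m))
  where
  prev : ℕ → ℕ
  prev zero    = 0
  prev (suc y) = at a y

firstOr : ℕ → (ℕ → Bool) → List ℕ → ℕ
firstOr d p []       = d
firstOr d p (i ∷ is) = if p i then i else firstOr d p is

ret : ℕ → ℕ → List ℕ → ℕ
ret m n a =
  let d  = gcd m n
      m₀ = div m d
      n₀ = div n d
  in firstOr d (λ i → through m n a (i * m₀) (i * n₀)) (applyUpTo suc d)

-- Laurent polynomials in q, t with integer coefficients, represented as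
-- finite lists of monomials (c , e_q , e_t) meaning c q^{e_q} t^{e_t}.
-- Two such are equal iff all their coefficients agree.

LPoly : Set
LPoly = List (ℤ × ℤ × ℤ)

coeff : LPoly → ℤ → ℤ → ℤ
coeff P i j =
  sumZ (map (λ { (c , eq , et) → if does (eq ℤ.≟ i) ∧ does (et ℤ.≟ j) then c else + 0 }) P)

-- For a symmetric function f of degree n and a partition λ with ℓ parts,
--   [s_λ] f = [x^{λ+δ}] (a_δ · f(x_1,…,x_ℓ))
--           = Σ_{w ∈ S_ℓ} sgn(w) [x^{λ+δ-w(δ)}] f(x_1,…,x_ℓ),   δ = (ℓ-1,…,0),
-- and [x^β] F_α = 1 if Set(α) ⊆ {β_1+…+β_k : 1 ≤ k < ℓ} (β ≥ 0), else 0.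
-- schurF λ S is the resulting linear functional applied to F_α with Set(α) = S;
-- applied to the F-expansion of a symmetric function it gives [s_λ] exactly.

schurF : List ℕ → List ℕ → ℤ
schurF λp S =
  let ℓ = length λp in
  sumZ (map (λ w →
    let β : ℕ → ℤ
        β j = (+ at λp j ℤ.- + j) ℤ.+ + at w j
        nonneg = allB (λ j → not (ltZ (β j) (+ 0))) (upTo ℓ)
        psum : ℕ → ℕ
        psum k = sum (map (λ j → ℤ.∣ β j ∣) (upTo k))
        ok = allB (λ s → anyB (λ k → psum k ≡ᵇ s) (applyUpTo suc (ℓ ∸ 1))) S
    in if nonneg ∧ ok then sign w else + 0)
    (perms ℓ))

-- [r]_{1/t} t^{area} q^{dinv} contributions:  [s_λ]_{m,n}  =  [s_λ] H_{m,n}[X;q,t]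
schurCoeffH : ℕ → ℕ → List ℕ → LPoly
schurCoeffH m n λp =
  concatMap (λ { (a , w) →
      map (λ j → (schurF λp (compSet (pides m n a w)) , dinv m n a w , + area m n a ℤ.- + j))
          (upTo (ret m n a)) })
    (PF m n)

-- A three-row path is (0, x₁, x₂), and (x₁, x₂) ↦ (x₁ + 1, x₂ + 2) maps the (m,3)-Dyck paths P
-- onto the (m+3,3)-Dyck paths P′ that can contribute to [s₃]: the others have two cars in one
-- column, and then every labelling has an ascent. The shift keeps area and ret, and it keeps the
-- level m y − 3 x of each row y; a rank is its level plus an offset ⌊x d / m⌋ < d, d = gcd(m,3),
-- while levels are multiples of d, so the rows of P and of P′ are ordered by rank in the same way.
-- [s₁₁₁] sees only the labelling of P with increasing ranks, whose tdinv is maxdinv(P), so its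
-- dinv is pdinv(P). [s₃] sees only the labelling of P′ with decreasing ranks, whose tdinv is 0;
-- pdinv(P′) = pdinv(P) + 2 + [the cell (0,2) of λ(P′) counts] and maxdinv(P′) = 2 + [rows 0 and 2
-- of P′ form a tdinv pair], and both brackets say that the level of row 2 is below m + 3.

module Submission where

open import Defs
open import Data.Nat as ℕ using (ℕ; zero; suc; _+_; _*_; _∸_; _/_; _≤_; _<_; _≤ᵇ_; _<ᵇ_; _≡ᵇ_; _⊔_; _≤?_; _≟_; z≤n; s≤s; NonZero)
import Data.Nat.Properties as ℕ
open import Data.Nat.DivMod using (m<n*o⇒m/o<n; m≥n⇒m/n>0; +-distrib-/-∣ʳ; +-distrib-/-∣ˡ; n/n≡1; m*n/n≡m)
open import Data.Nat.Divisibility using (_∣_; divides; ∣-refl; ∣-trans; ∣-antisym; ∣m+n∣m⇒∣n; ∣m∣n⇒∣m+n; ∣⇒≤; n∣m*n; m∣m*n)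
open import Data.Nat.GCD using (gcd; gcd[m,n]∣m; gcd[m,n]∣n; gcd-greatest; gcd[m,n]≤n; gcd[m,n]≢0)
open import Data.Nat.Primality using (prime?; prime⇒irreducible)
open import Data.Nat.Tactic.RingSolver using (solve-∀)
open import Data.Integer as ℤ using (ℤ; +_)
import Data.Integer.Properties as ℤ
open import Data.Bool using (Bool; true; false; T; _∧_; _∨_; not; if_then_else_)
open import Data.Bool.Properties using (∧-identityʳ; ∧-zeroʳ; ∨-zeroʳ; if-eta)
open import Data.List using (List; []; _∷_; _++_; map; concatMap; foldr; replicate; length; upTo; applyUpTo)
open import Data.List.Properties using (map-++; map-∘; map-cong)
open import Data.List.Relation.Unary.All using (All; []; _∷_)
open import Data.List.Relation.Unary.Any using (here; there)
open import Data.List.Membership.Propositional using (_∈_)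
open import Data.List.Relation.Binary.Pointwise using (Pointwise; Pointwise-≡⇒≡; []; _∷_)
open import Data.Product using (_×_; _,_; proj₁; proj₂)
open import Data.Sum using (_⊎_; inj₁; inj₂)
open import Function using (_∘_; _⇔_; mk⇔; Equivalence)
open import Relation.Nullary using (Dec; does; yes; no; ¬_)
open import Relation.Nullary.Decidable using (_×-dec_; map′; dec-true; dec-false; does-⇔; from-yes)
open import Relation.Binary.Definitions using (tri<; tri≈; tri>)
open import Relation.Binary.PropositionalEquality

cong₃ : ∀ {A B C D : Set} (f : A → B → C → D) {x y z u v w} → x ≡ u → y ≡ v → z ≡ w → f x y z ≡ f u v w
cong₃ f refl refl refl = refl

sumBelow : ℕ → (ℕ → ℤ) → ℤ
sumBelow zero    f = + 0
sumBelow (suc n) f = f 0 ℤ.+ sumBelow n (f ∘ suc)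

sumBelow² : ℕ → ℕ → (ℕ → ℕ → ℤ) → ℤ
sumBelow² p q f = sumBelow p (λ x₁ → sumBelow q (f x₁))

sumZ-++ : ∀ xs ys → sumZ (xs ++ ys) ≡ sumZ xs ℤ.+ sumZ ys
sumZ-++ []       ys = sym (ℤ.+-identityˡ _)
sumZ-++ (x ∷ xs) ys = trans (cong (ℤ._+_ x) (sumZ-++ xs ys)) (sym (ℤ.+-assoc x _ _))

sumZ-map-concatMap : {A B : Set} (h : B → ℤ) (f : A → List B) (xs : List A) →
  sumZ (map h (concatMap f xs)) ≡ sumZ (map (λ x → sumZ (map h (f x))) xs)
sumZ-map-concatMap h f []       = refl
sumZ-map-concatMap h f (x ∷ xs) = begin
  sumZ (map h (f x ++ concatMap f xs))              ≡⟨ cong sumZ (map-++ h (f x) _) ⟩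
  sumZ (map h (f x) ++ map h (concatMap f xs))      ≡⟨ sumZ-++ (map h (f x)) _ ⟩
  sumZ (map h (f x)) ℤ.+ sumZ (map h (concatMap f xs))
                                                    ≡⟨ cong (ℤ._+_ (sumZ (map h (f x)))) (sumZ-map-concatMap h f xs) ⟩
  sumZ (map (λ x → sumZ (map h (f x))) (x ∷ xs))    ∎
  where open ≡-Reasoning

sumZ-map-filterB : {A : Set} (h : A → ℤ) (p : A → Bool) (xs : List A) →
  sumZ (map h (filterB p xs)) ≡ sumZ (map (λ x → if p x then h x else + 0) xs)
sumZ-map-filterB h p []       = refl
sumZ-map-filterB h p (x ∷ xs) with p x
... | true  = cong (ℤ._+_ (h x)) (sumZ-map-filterB h p xs)
... | false = trans (sumZ-map-filterB h p xs) (sym (ℤ.+-identityˡ _))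

sumZ-map-applyUpTo : (h : ℕ → ℤ) (f : ℕ → ℕ) (n : ℕ) →
  sumZ (map h (applyUpTo f n)) ≡ sumBelow n (h ∘ f)
sumZ-map-applyUpTo h f zero    = refl
sumZ-map-applyUpTo h f (suc n) = cong (ℤ._+_ (h (f 0))) (sumZ-map-applyUpTo h (f ∘ suc) n)

sumBelow-cong : ∀ n {f g : ℕ → ℤ} → (∀ i → f i ≡ g i) → sumBelow n f ≡ sumBelow n g
sumBelow-cong zero    eq = refl
sumBelow-cong (suc n) eq = cong₂ ℤ._+_ (eq 0) (sumBelow-cong n (eq ∘ suc))

sumBelow-zero : ∀ n {f : ℕ → ℤ} → (∀ i → f i ≡ + 0) → sumBelow n f ≡ + 0
sumBelow-zero zero    eq = refl
sumBelow-zero (suc n) eq = cong₂ ℤ._+_ (eq 0) (sumBelow-zero n (eq ∘ suc))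

sumBelow-dropFront : ∀ k n {f : ℕ → ℤ} → (∀ i → i < k → f i ≡ + 0) →
  sumBelow (k + n) f ≡ sumBelow n (λ i → f (k + i))
sumBelow-dropFront zero    n vanish = refl
sumBelow-dropFront (suc k) n vanish = trans
  (cong₂ ℤ._+_ (vanish 0 (s≤s z≤n)) (sumBelow-dropFront k n (λ i i<k → vanish (suc i) (s≤s i<k))))
  (ℤ.+-identityˡ _)

sumBelow-dropBack : ∀ k n {f : ℕ → ℤ} → (∀ i → n ≤ i → f i ≡ + 0) → sumBelow (k + n) f ≡ sumBelow n f
sumBelow-dropBack k n {f} vanish = trans (cong (λ r → sumBelow r f) (ℕ.+-comm k n)) (go n vanish)
  where
  go : ∀ n {f : ℕ → ℤ} → (∀ i → n ≤ i → f i ≡ + 0) → sumBelow (n + k) f ≡ sumBelow n f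
  go zero        vanish = sumBelow-zero k (λ i → vanish i z≤n)
  go (suc n) {f} vanish = cong (ℤ._+_ (f 0)) (go n (λ i n≤i → vanish (suc i) (s≤s n≤i)))

sumBelow²-cong : ∀ p q {f g : ℕ → ℕ → ℤ} → (∀ x₁ x₂ → f x₁ x₂ ≡ g x₁ x₂) → sumBelow² p q f ≡ sumBelow² p q g
sumBelow²-cong p q eq = sumBelow-cong p (λ x₁ → sumBelow-cong q (eq x₁))

sumBelow²-dropFront : ∀ k l p q {f : ℕ → ℕ → ℤ} → (∀ x₁ x₂ → x₁ < k ⊎ x₂ < l → f x₁ x₂ ≡ + 0) →
  sumBelow² (k + p) (l + q) f ≡ sumBelow² p q (λ x₁ x₂ → f (k + x₁) (l + x₂))
sumBelow²-dropFront k l p q vanish = trans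
  (sumBelow-dropFront k p (λ x₁ x₁<k → sumBelow-zero (l + q) (λ x₂ → vanish x₁ x₂ (inj₁ x₁<k))))
  (sumBelow-cong p (λ x₁ → sumBelow-dropFront l q (λ x₂ x₂<l → vanish (k + x₁) x₂ (inj₂ x₂<l))))

sumBelow²-dropBack : ∀ k l p q {f : ℕ → ℕ → ℤ} → (∀ x₁ x₂ → p ≤ x₁ ⊎ q ≤ x₂ → f x₁ x₂ ≡ + 0) →
  sumBelow² (k + p) (l + q) f ≡ sumBelow² p q f
sumBelow²-dropBack k l p q vanish = trans
  (sumBelow-dropBack k p (λ x₁ p≤x₁ → sumBelow-zero (l + q) (λ x₂ → vanish x₁ x₂ (inj₁ p≤x₁))))
  (sumBelow-cong p (λ x₁ → sumBelow-dropBack l q (λ x₂ q≤x₂ → vanish x₁ x₂ (inj₂ q≤x₂))))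

sumZ-zeros : ∀ l → sumZ (replicate l (+ 0)) ≡ + 0
sumZ-zeros zero    = refl
sumZ-zeros (suc l) = cong (ℤ._+_ (+ 0)) (sumZ-zeros l)

sumZ-single : ∀ k l x → sumZ (replicate k (+ 0) ++ x ∷ replicate l (+ 0)) ≡ x
sumZ-single zero    l x = trans (cong (ℤ._+_ x) (sumZ-zeros l)) (ℤ.+-identityʳ x)
sumZ-single (suc k) l x = trans (ℤ.+-identityˡ _) (sumZ-single k l x)

-- The coefficient as a sum over three-row Dyck paths

-- c q^e t^A [r]_{1/t}, as the list of its monomials c q^e t^(A-j), j < r.
qtTerms : ℤ → ℤ → ℕ → ℕ → LPoly
qtTerms c e A r = map (λ j → (c , e , + A ℤ.- + j)) (upTo r)

pfTerms : ℕ → ℕ → List ℕ → List ℕ → List ℕ → LPoly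
pfTerms m n λp a w = qtTerms (schurF λp (compSet (pides m n a w))) (dinv m n a w) (area m n a) (ret m n a)

pathWeight : ℕ → ℕ → List ℕ → ℤ → ℤ → List ℕ → ℤ
pathWeight m n λp i j a = sumZ (map (λ w → coeff (pfTerms m n λp a w) i j) (labelings n a))

coeff-schurCoeffH : ∀ m n λp i j → coeff (schurCoeffH m n λp) i j ≡
  sumZ (map (λ a → if isDyck m n a then pathWeight m n λp i j a else + 0) (seqs m n))
coeff-schurCoeffH m n λp i j = begin
  coeff (schurCoeffH m n λp) i j
    ≡⟨ sumZ-map-concatMap _ (λ aw → pfTerms m n λp (proj₁ aw) (proj₂ aw)) (PF m n) ⟩
  sumZ (map (λ aw → coeff (pfTerms m n λp (proj₁ aw) (proj₂ aw)) i j) (PF m n))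
    ≡⟨ sumZ-map-concatMap _ (λ a → map (a ,_) (labelings n a)) (dyckPaths m n) ⟩
  sumZ (map (λ a → sumZ (map (λ aw → coeff (pfTerms m n λp (proj₁ aw) (proj₂ aw)) i j) (map (a ,_) (labelings n a))))
            (dyckPaths m n))
    ≡⟨ cong sumZ (map-cong (λ a → cong sumZ (sym (map-∘ (labelings n a)))) (dyckPaths m n)) ⟩
  sumZ (map (pathWeight m n λp i j) (dyckPaths m n))
    ≡⟨ sumZ-map-filterB (pathWeight m n λp i j) (isDyck m n) (seqs m n) ⟩
  sumZ (map (λ a → if isDyck m n a then pathWeight m n λp i j a else + 0) (seqs m n)) ∎
  where open ≡-Reasoning

path₃ : ℕ → ℕ → List ℕ
path₃ x₁ x₂ = 0 ∷ x₁ ∷ x₂ ∷ []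

-- The conditions 3 x_y ≤ m y in the form isDyck evaluates them (m * 1, m * 2).
record Dyck₃ (m x₁ x₂ : ℕ) : Set where
  constructor dyck₃
  field
    monotone : x₁ ≤ x₂
    row₁     : 3 * x₁ ≤ m * 1
    row₂     : 3 * x₂ ≤ m * 2

dyck₃? : ∀ m x₁ x₂ → Dec (Dyck₃ m x₁ x₂)
dyck₃? m x₁ x₂ = map′ (λ (p , q , r) → dyck₃ p q r) (λ (dyck₃ p q r) → p , q , r)
  (x₁ ≤? x₂ ×-dec 3 * x₁ ≤? m * 1 ×-dec 3 * x₂ ≤? m * 2)

isDyck-path₃ : ∀ m x₁ x₂ → isDyck m 3 (path₃ x₁ x₂) ≡ does (dyck₃? m x₁ x₂)
isDyck-path₃ m x₁ x₂ =
  cong₂ _∧_ (∧-identityʳ (x₁ ≤ᵇ x₂)) (cong (_∧_ (3 * x₁ ≤ᵇ m * 1)) (∧-identityʳ (3 * x₂ ≤ᵇ m * 2)))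

isDyck-raised : ∀ m x₀ x₁ x₂ → isDyck m 3 (suc x₀ ∷ x₁ ∷ x₂ ∷ []) ≡ false
isDyck-raised m x₀ x₁ x₂ rewrite ℕ.*-zeroʳ m = ∧-zeroʳ _

dyckWeight : ℕ → List ℕ → ℤ → ℤ → ℕ → ℕ → ℤ
dyckWeight m λp i j x₁ x₂ =
  if isDyck m 3 (path₃ x₁ x₂) then pathWeight m 3 λp i j (path₃ x₁ x₂) else + 0

dyckWeight-dyck : ∀ m λp i j x₁ x₂ → Dyck₃ m x₁ x₂ →
  dyckWeight m λp i j x₁ x₂ ≡ pathWeight m 3 λp i j (path₃ x₁ x₂)
dyckWeight-dyck m λp i j x₁ x₂ d
  rewrite isDyck-path₃ m x₁ x₂ | dec-true (dyck₃? m x₁ x₂) d = refl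

dyckWeight-¬dyck : ∀ m λp i j x₁ x₂ → ¬ Dyck₃ m x₁ x₂ → dyckWeight m λp i j x₁ x₂ ≡ + 0
dyckWeight-¬dyck m λp i j x₁ x₂ ¬d
  rewrite isDyck-path₃ m x₁ x₂ | dec-false (dyck₃? m x₁ x₂) ¬d = refl

dyckWeight-vanishes : ∀ m λp i j x₁ x₂ → (Dyck₃ m x₁ x₂ → pathWeight m 3 λp i j (path₃ x₁ x₂) ≡ + 0) →
  dyckWeight m λp i j x₁ x₂ ≡ + 0
dyckWeight-vanishes m λp i j x₁ x₂ vanish with dyck₃? m x₁ x₂
... | yes d = trans (dyckWeight-dyck m λp i j x₁ x₂ d) (vanish d)
... | no ¬d = dyckWeight-¬dyck m λp i j x₁ x₂ ¬d

dyckWeight-beyond : ∀ m λp i j x₁ x₂ → m < x₁ ⊎ m < x₂ → dyckWeight m λp i j x₁ x₂ ≡ + 0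
dyckWeight-beyond m λp i j x₁ x₂ (inj₁ m<x₁) = dyckWeight-¬dyck m λp i j x₁ x₂ λ (dyck₃ _ row₁ _) →
  ℕ.<⇒≱ m<x₁ (ℕ.≤-trans (ℕ.m≤n*m x₁ 3) (subst (3 * x₁ ≤_) (ℕ.*-identityʳ m) row₁))
dyckWeight-beyond m λp i j x₁ x₂ (inj₂ m<x₂) = dyckWeight-¬dyck m λp i j x₁ x₂ λ (dyck₃ _ _ row₂) →
  ℕ.<⇒≱ (ℕ.*-monoʳ-< 3 m<x₂)
    (ℕ.≤-trans row₂ (subst (m * 2 ≤_) (ℕ.*-comm m 3) (ℕ.*-monoʳ-≤ m (s≤s (s≤s z≤n)))))

sumZ-seqs : ∀ m k (h : List ℕ → ℤ) →
  sumZ (map h (seqs m (suc k))) ≡ sumBelow (suc m) (λ x → sumZ (map (h ∘ (x ∷_)) (seqs m k)))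
sumZ-seqs m k h = begin
  sumZ (map h (seqs m (suc k)))
    ≡⟨ sumZ-map-concatMap h (λ x → map (x ∷_) (seqs m k)) (upTo (suc m)) ⟩
  sumZ (map (λ x → sumZ (map h (map (x ∷_) (seqs m k)))) (upTo (suc m)))
    ≡⟨ sumZ-map-applyUpTo (λ x → sumZ (map h (map (x ∷_) (seqs m k)))) (λ x → x) (suc m) ⟩
  sumBelow (suc m) (λ x → sumZ (map h (map (x ∷_) (seqs m k))))
    ≡⟨ sumBelow-cong (suc m) (λ x → cong sumZ (sym (map-∘ {g = h} {f = x ∷_} (seqs m k)))) ⟩
  sumBelow (suc m) (λ x → sumZ (map (h ∘ (x ∷_)) (seqs m k))) ∎
  where open ≡-Reasoning

sumZ-seqs₃ : ∀ m (h : List ℕ → ℤ) →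
  sumZ (map h (seqs m 3)) ≡
  sumBelow (suc m) (λ x₀ → sumBelow² (suc m) (suc m) (λ x₁ x₂ → h (x₀ ∷ x₁ ∷ x₂ ∷ [])))
sumZ-seqs₃ m h = trans (sumZ-seqs m 2 h) (sumBelow-cong (suc m) λ x₀ →
  trans (sumZ-seqs m 1 (h ∘ (x₀ ∷_))) (sumBelow-cong (suc m) λ x₁ →
  trans (sumZ-seqs m 0 (h ∘ (x₀ ∷_) ∘ (x₁ ∷_))) (sumBelow-cong (suc m) λ x₂ →
  ℤ.+-identityʳ (h (x₀ ∷ x₁ ∷ x₂ ∷ [])))))

coeff-schurCoeffH₃ : ∀ m λp i j → coeff (schurCoeffH m 3 λp) i j ≡ sumBelow² (suc m) (suc m) (dyckWeight m λp i j)
coeff-schurCoeffH₃ m λp i j = begin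
  coeff (schurCoeffH m 3 λp) i j                 ≡⟨ coeff-schurCoeffH m 3 λp i j ⟩
  sumZ (map weight (seqs m 3))                   ≡⟨ sumZ-seqs₃ m weight ⟩
  sumBelow² (suc m) (suc m) (dyckWeight m λp i j) ℤ.+ sumBelow m raised
                                                 ≡⟨ cong (ℤ._+_ (sumBelow² (suc m) (suc m) (dyckWeight m λp i j))) raised≡0 ⟩
  sumBelow² (suc m) (suc m) (dyckWeight m λp i j) ℤ.+ + 0
                                                 ≡⟨ ℤ.+-identityʳ _ ⟩
  sumBelow² (suc m) (suc m) (dyckWeight m λp i j) ∎
  where
  open ≡-Reasoning
  weight : List ℕ → ℤ
  weight a = if isDyck m 3 a then pathWeight m 3 λp i j a else + 0
  raised : ℕ → ℤ
  raised x₀ = sumBelow² (suc m) (suc m) (λ x₁ x₂ → weight (suc x₀ ∷ x₁ ∷ x₂ ∷ []))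
  raised≡0 : sumBelow m raised ≡ + 0
  raised≡0 = sumBelow-zero m λ x₀ → sumBelow-zero (suc m) λ x₁ → sumBelow-zero (suc m) λ x₂ →
    cong (λ b → if b then pathWeight m 3 λp i j (suc x₀ ∷ x₁ ∷ x₂ ∷ []) else + 0) (isDyck-raised m x₀ x₁ x₂)

-- Labellings of a three-row path

ascent : ℕ → ℕ → List ℕ → List ℕ → ℕ → Bool
ascent m n a w i = ltZ (carRank m n a w (i ∸ 1)) (carRank m n a w i)

schurF-111-pides : ∀ m a w →
  schurF (1 ∷ 1 ∷ 1 ∷ []) (compSet (pides m 3 a w)) ≡ (if ascent m 3 a w 1 ∧ ascent m 3 a w 2 then + 1 else + 0)
schurF-111-pides m a w with ascent m 3 a w 1 | ascent m 3 a w 2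
... | true  | true  = refl
... | true  | false = refl
... | false | true  = refl
... | false | false = refl

schurF-3-pides : ∀ m a w →
  schurF (3 ∷ []) (compSet (pides m 3 a w)) ≡ (if ascent m 3 a w 1 ∨ ascent m 3 a w 2 then + 0 else + 1)
schurF-3-pides m a w with ascent m 3 a w 1 | ascent m 3 a w 2
... | true  | true  = refl
... | true  | false = refl
... | false | true  = refl
... | false | false = refl

ltZ-true : ∀ {x y} → x ℤ.< y → ltZ x y ≡ true
ltZ-true {x} {y} = dec-true (x ℤ.<? y)

ltZ-false : ∀ {x y} → y ℤ.< x → ltZ x y ≡ false
ltZ-false {x} {y} y<x = dec-false (x ℤ.<? y) (ℤ.<-asym y<x)

coeff-zero-coefficients : {A : Set} (f g : A → ℤ) (xs : List A) (i j : ℤ) →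
  coeff (map (λ x → (+ 0 , f x , g x)) xs) i j ≡ + 0
coeff-zero-coefficients f g []       i j = refl
coeff-zero-coefficients f g (x ∷ xs) i j with does (f x ℤ.≟ i) ∧ does (g x ℤ.≟ j)
... | true  = trans (ℤ.+-identityˡ _) (coeff-zero-coefficients f g xs i j)
... | false = trans (ℤ.+-identityˡ _) (coeff-zero-coefficients f g xs i j)

labelWeight : ℕ → List ℕ → ℤ → ℤ → List ℕ → List ℕ → ℤ
labelWeight m λp i j a w = if colIncreasing 3 a w then coeff (pfTerms m 3 λp a w) i j else + 0

pathWeight-perms : ∀ m λp i j a → pathWeight m 3 λp i j a ≡ sumZ (map (labelWeight m λp i j a) (perms 3))
pathWeight-perms m λp i j a = sumZ-map-filterB _ (colIncreasing 3 a) (perms 3)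

labelWeight-schurF≡0 : ∀ {m λp i j a w} → schurF λp (compSet (pides m 3 a w)) ≡ + 0 → labelWeight m λp i j a w ≡ + 0
labelWeight-schurF≡0 {m} {λp} {i} {j} {a} {w} eq with colIncreasing 3 a w
... | false = refl
... | true  rewrite eq =
  coeff-zero-coefficients (λ _ → dinv m 3 a w) (λ k → + area m 3 a ℤ.- + k) (upTo (ret m 3 a)) i j

labelWeight-schurF≡1 : ∀ {m λp i j a w} → colIncreasing 3 a w ≡ true → schurF λp (compSet (pides m 3 a w)) ≡ + 1 →
  labelWeight m λp i j a w ≡ coeff (qtTerms (+ 1) (dinv m 3 a w) (area m 3 a) (ret m 3 a)) i j
labelWeight-schurF≡1 col eq rewrite col | eq = refl

module LabelWeights (m : ℕ) (i j : ℤ) (a : List ℕ) where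

  private
    ρ : ℕ → ℤ
    ρ = rowRank m 3 a

    w111-≡0 : ∀ w → ascent m 3 a w 1 ∧ ascent m 3 a w 2 ≡ false →
      labelWeight m (1 ∷ 1 ∷ 1 ∷ []) i j a w ≡ + 0
    w111-≡0 w d = labelWeight-schurF≡0 {m} {1 ∷ 1 ∷ 1 ∷ []} {i} {j} {a} {w}
      (trans (schurF-111-pides m a w) (cong (λ b → if b then + 1 else + 0) d))

    w3-≡0 : ∀ w → ascent m 3 a w 1 ∨ ascent m 3 a w 2 ≡ true → labelWeight m (3 ∷ []) i j a w ≡ + 0
    w3-≡0 w u = labelWeight-schurF≡0 {m} {3 ∷ []} {i} {j} {a} {w}
      (trans (schurF-3-pides m a w) (cong (λ b → if b then + 0 else + 1) u))

  module _ {w₀ w₁ w₂ : ℕ} where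

    private
      w : List ℕ
      w = w₀ ∷ w₁ ∷ w₂ ∷ []

    weight-111-descent₁ : ρ w₁ ℤ.< ρ w₀ → labelWeight m (1 ∷ 1 ∷ 1 ∷ []) i j a (w₀ ∷ w₁ ∷ w₂ ∷ []) ≡ + 0
    weight-111-descent₁ d = w111-≡0 w (cong (_∧ ascent m 3 a w 2) (ltZ-false d))

    weight-111-descent₂ : ρ w₂ ℤ.< ρ w₁ → labelWeight m (1 ∷ 1 ∷ 1 ∷ []) i j a (w₀ ∷ w₁ ∷ w₂ ∷ []) ≡ + 0
    weight-111-descent₂ d = w111-≡0 w (trans (cong (ascent m 3 a w 1 ∧_) (ltZ-false d)) (∧-zeroʳ _))

    weight-3-ascent₁ : ρ w₀ ℤ.< ρ w₁ → labelWeight m (3 ∷ []) i j a (w₀ ∷ w₁ ∷ w₂ ∷ []) ≡ + 0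
    weight-3-ascent₁ u = w3-≡0 w (cong (_∨ ascent m 3 a w 2) (ltZ-true u))

    weight-3-ascent₂ : ρ w₁ ℤ.< ρ w₂ → labelWeight m (3 ∷ []) i j a (w₀ ∷ w₁ ∷ w₂ ∷ []) ≡ + 0
    weight-3-ascent₂ u = w3-≡0 w (trans (cong (ascent m 3 a w 1 ∨_) (ltZ-true u)) (∨-zeroʳ _))

    weight-3-ascent₀₂ : ρ w₀ ℤ.< ρ w₂ → labelWeight m (3 ∷ []) i j a (w₀ ∷ w₁ ∷ w₂ ∷ []) ≡ + 0
    weight-3-ascent₀₂ u with ℤ.<-cmp (ρ w₀) (ρ w₁)
    ... | tri< u₁ _ _ = weight-3-ascent₁ u₁
    ... | tri≈ _ eq _ = weight-3-ascent₂ (subst (ℤ._< ρ w₂) eq u)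
    ... | tri> _ _ d₁ = weight-3-ascent₂ (ℤ.<-trans d₁ u)

    weight-111-ascending : colIncreasing 3 a (w₀ ∷ w₁ ∷ w₂ ∷ []) ≡ true → ρ w₀ ℤ.< ρ w₁ → ρ w₁ ℤ.< ρ w₂ →
      labelWeight m (1 ∷ 1 ∷ 1 ∷ []) i j a (w₀ ∷ w₁ ∷ w₂ ∷ []) ≡
      coeff (qtTerms (+ 1) (dinv m 3 a (w₀ ∷ w₁ ∷ w₂ ∷ [])) (area m 3 a) (ret m 3 a)) i j
    weight-111-ascending col u₁ u₂ = labelWeight-schurF≡1 {m} {1 ∷ 1 ∷ 1 ∷ []} {i} {j} {a} {w} col
      (trans (schurF-111-pides m a w) (cong₂ (λ b c → if b ∧ c then + 1 else + 0) (ltZ-true u₁) (ltZ-true u₂)))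

    weight-3-descending : colIncreasing 3 a (w₀ ∷ w₁ ∷ w₂ ∷ []) ≡ true → ρ w₁ ℤ.< ρ w₀ → ρ w₂ ℤ.< ρ w₁ →
      labelWeight m (3 ∷ []) i j a (w₀ ∷ w₁ ∷ w₂ ∷ []) ≡
      coeff (qtTerms (+ 1) (dinv m 3 a (w₀ ∷ w₁ ∷ w₂ ∷ [])) (area m 3 a) (ret m 3 a)) i j
    weight-3-descending col d₁ d₂ = labelWeight-schurF≡1 {m} {3 ∷ []} {i} {j} {a} {w} col
      (trans (schurF-3-pides m a w) (cong₂ (λ b c → if b ∨ c then + 0 else + 1) (ltZ-false d₁) (ltZ-false d₂)))

pathWeight-unique-labelling : ∀ m λp i j a k l {x} →
  Pointwise _≡_ (map (labelWeight m λp i j a) (perms 3)) (replicate k (+ 0) ++ x ∷ replicate l (+ 0)) →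
  pathWeight m 3 λp i j a ≡ x
pathWeight-unique-labelling m λp i j a k l {x} eqs =
  trans (pathWeight-perms m λp i j a) (trans (cong sumZ (Pointwise-≡⇒≡ eqs)) (sumZ-single k l x))

-- Row 0 has rank 0 and the other rows have positive rank, so the rank order of the rows is
-- fixed by how rows 1 and 2 compare.
data RowOrder : ℕ → ℕ → Set where
  rows12 : RowOrder 1 2
  rows21 : RowOrder 2 1

RanksIncrease : ℕ → List ℕ → ℕ → ℕ → Set
RanksIncrease m a u v = rowRank m 3 a 0 ℤ.< rowRank m 3 a u × rowRank m 3 a u ℤ.< rowRank m 3 a v

pathWeight-111-sorted : ∀ {m i j a u v} → RowOrder u v → RanksIncrease m a u v →
  colIncreasing 3 a (0 ∷ u ∷ v ∷ []) ≡ true →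
  pathWeight m 3 (1 ∷ 1 ∷ 1 ∷ []) i j a ≡ coeff (qtTerms (+ 1) (dinv m 3 a (0 ∷ u ∷ v ∷ [])) (area m 3 a) (ret m 3 a)) i j
pathWeight-111-sorted {m} {i} {j} {a} rows12 (r₀₁ , r₁₂) col = pathWeight-unique-labelling m (1 ∷ 1 ∷ 1 ∷ []) i j a 0 5
  (  weight-111-ascending col r₀₁ r₁₂
  ∷ weight-111-descent₁ r₀₁
  ∷ weight-111-descent₂ (ℤ.<-trans r₀₁ r₁₂)
  ∷ weight-111-descent₂ r₁₂
  ∷ weight-111-descent₁ (ℤ.<-trans r₀₁ r₁₂)
  ∷ weight-111-descent₁ r₁₂ ∷ [])
  where open LabelWeights m i j a
pathWeight-111-sorted {m} {i} {j} {a} rows21 (r₀₂ , r₂₁) col = pathWeight-unique-labelling m (1 ∷ 1 ∷ 1 ∷ []) i j a 3 2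
  (  weight-111-descent₂ r₂₁
  ∷ weight-111-descent₁ (ℤ.<-trans r₀₂ r₂₁)
  ∷ weight-111-descent₁ r₂₁
  ∷ weight-111-ascending col r₀₂ r₂₁
  ∷ weight-111-descent₁ r₀₂
  ∷ weight-111-descent₂ (ℤ.<-trans r₀₂ r₂₁) ∷ [])
  where open LabelWeights m i j a

pathWeight-3-reversed : ∀ {m i j a u v} → RowOrder u v → RanksIncrease m a u v →
  colIncreasing 3 a (v ∷ u ∷ 0 ∷ []) ≡ true →
  pathWeight m 3 (3 ∷ []) i j a ≡ coeff (qtTerms (+ 1) (dinv m 3 a (v ∷ u ∷ 0 ∷ [])) (area m 3 a) (ret m 3 a)) i j
pathWeight-3-reversed {m} {i} {j} {a} rows12 (r₀₁ , r₁₂) col = pathWeight-unique-labelling m (3 ∷ []) i j a 5 0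
  (  weight-3-ascent₁ r₀₁
  ∷ weight-3-ascent₂ (ℤ.<-trans r₀₁ r₁₂)
  ∷ weight-3-ascent₁ r₁₂
  ∷ weight-3-ascent₁ (ℤ.<-trans r₀₁ r₁₂)
  ∷ weight-3-ascent₂ r₀₁
  ∷ weight-3-descending col r₁₂ r₀₁ ∷ [])
  where open LabelWeights m i j a
pathWeight-3-reversed {m} {i} {j} {a} rows21 (r₀₂ , r₂₁) col = pathWeight-unique-labelling m (3 ∷ []) i j a 2 3
  (  weight-3-ascent₁ (ℤ.<-trans r₀₂ r₂₁)
  ∷ weight-3-ascent₂ r₀₂
  ∷ weight-3-descending col r₂₁ r₀₂
  ∷ weight-3-ascent₁ r₀₂
  ∷ weight-3-ascent₂ (ℤ.<-trans r₀₂ r₂₁)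
  ∷ weight-3-ascent₁ r₂₁ ∷ [])
  where open LabelWeights m i j a

allB-false : {A : Set} {p : A → Bool} {x : A} {xs : List A} → x ∈ xs → p x ≡ false → allB p xs ≡ false
allB-false {p = p} {xs = y ∷ ys} (here refl) px = cong (_∧ allB p ys) px
allB-false {p = p} {xs = y ∷ ys} (there x∈) px = trans (cong (p y ∧_) (allB-false x∈ px)) (∧-zeroʳ (p y))

colIncreasing-violated : ∀ n a w {p q} → (p , q) ∈ pairsLt n → at a (at w p) ≡ at a (at w q) → at w q < at w p →
  colIncreasing n a w ≡ false
colIncreasing-violated n a w {p} {q} pq∈ same below = allB-false pq∈ violated
  where
  violated : not (at a (at w p) ≡ᵇ at a (at w q)) ∨ (at w p <ᵇ at w q) ≡ false
  violated rewrite same | dec-true (at a (at w q) ℕ.≟ at a (at w q)) refl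
    = dec-false (at w p ℕ.<? at w q) (ℕ.<⇒≯ below)

module ColumnClash (m : ℕ) (λp : List ℕ) (i j : ℤ) (a : List ℕ) where

  labelWeight-¬colIncreasing : ∀ {w} → colIncreasing 3 a w ≡ false → labelWeight m λp i j a w ≡ + 0
  labelWeight-¬colIncreasing ¬col rewrite ¬col = refl

  labelWeight-column-violated : ∀ {w p q} → (p , q) ∈ pairsLt 3 → at a (at w p) ≡ at a (at w q) → at w q < at w p →
    labelWeight m λp i j a w ≡ + 0
  labelWeight-column-violated {w} pq∈ same below = labelWeight-¬colIncreasing {w} (colIncreasing-violated 3 a w pq∈ same below)

≡ᵇ-false : ∀ {x y} → ¬ x ≡ y → (x ≡ᵇ y) ≡ false
≡ᵇ-false {x} {y} = dec-false (x ≟ y)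

colIncreasing-012 : ∀ x₁ x₂ → colIncreasing 3 (path₃ x₁ x₂) (0 ∷ 1 ∷ 2 ∷ []) ≡ true
colIncreasing-012 x₁ x₂
  rewrite ∨-zeroʳ (not (0 ≡ᵇ x₁)) | ∨-zeroʳ (not (0 ≡ᵇ x₂)) | ∨-zeroʳ (not (x₁ ≡ᵇ x₂)) = refl

colIncreasing-021 : ∀ {x₁ x₂} → ¬ x₁ ≡ x₂ → colIncreasing 3 (path₃ x₁ x₂) (0 ∷ 2 ∷ 1 ∷ []) ≡ true
colIncreasing-021 {x₁} {x₂} x₁≢x₂
  rewrite ∨-zeroʳ (not (0 ≡ᵇ x₂)) | ∨-zeroʳ (not (0 ≡ᵇ x₁)) | ≡ᵇ-false (x₁≢x₂ ∘ sym) = refl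

colIncreasing-shifted : ∀ {u v x₁ x₂} → RowOrder u v → x₁ ≤ x₂ →
  colIncreasing 3 (path₃ (1 + x₁) (2 + x₂)) (v ∷ u ∷ 0 ∷ []) ≡ true
colIncreasing-shifted rows12 x₁≤x₂ rewrite ≡ᵇ-false (ℕ.>⇒≢ (s≤s x₁≤x₂)) = refl
colIncreasing-shifted rows21 x₁≤x₂ rewrite ≡ᵇ-false (ℕ.<⇒≢ (s≤s x₁≤x₂)) = refl

colIncreasing-shifted-sorted : ∀ {u v x₁ x₂} → RowOrder u v → x₁ ≤ x₂ →
  colIncreasing 3 (path₃ (1 + x₁) (2 + x₂)) (0 ∷ u ∷ v ∷ []) ≡ true
colIncreasing-shifted-sorted {x₁ = x₁} {x₂} rows12 _     = colIncreasing-012 (1 + x₁) (2 + x₂)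
colIncreasing-shifted-sorted rows21 x₁≤x₂ = colIncreasing-021 (ℕ.<⇒≢ (s≤s (s≤s x₁≤x₂)))

-- tdinv, maxdinv and dinv

module _ {A : Set} (f : A → ℕ) (c : A → Bool) where

  foldr-⊔-filterB-≤ : ∀ {v xs} → All (λ y → f y ≤ v) xs → foldr _⊔_ 0 (map f (filterB c xs)) ≤ v
  foldr-⊔-filterB-≤ []                    = z≤n
  foldr-⊔-filterB-≤ {xs = y ∷ _} (p ∷ ps) with c y
  ... | true  = ℕ.⊔-lub p (foldr-⊔-filterB-≤ ps)
  ... | false = foldr-⊔-filterB-≤ ps

  ≤-foldr-⊔-filterB : ∀ {x xs} → x ∈ xs → c x ≡ true → f x ≤ foldr _⊔_ 0 (map f (filterB c xs))
  ≤-foldr-⊔-filterB (here refl) cx rewrite cx = ℕ.m≤m⊔n _ _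
  ≤-foldr-⊔-filterB {xs = y ∷ _} (there x∈) cx with c y
  ... | true  = ℕ.≤-trans (≤-foldr-⊔-filterB x∈ cx) (ℕ.m≤n⊔m (f y) _)
  ... | false = ≤-foldr-⊔-filterB x∈ cx

  foldr-⊔-filterB-attained : ∀ {x xs} → x ∈ xs → c x ≡ true → All (λ y → f y ≤ f x) xs →
    foldr _⊔_ 0 (map f (filterB c xs)) ≡ f x
  foldr-⊔-filterB-attained x∈ cx bounds = ℕ.≤-antisym (foldr-⊔-filterB-≤ bounds) (≤-foldr-⊔-filterB x∈ cx)

-- tdinv m 3 a w is pairSum (tdinvPair m a) w by definition.
pairSum : (ℕ → ℕ → Bool) → List ℕ → ℕ
pairSum P w = count (λ { (p , q) → P (at w p) (at w q) }) (pairsLt 3)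

tdinvPair : ℕ → List ℕ → ℕ → ℕ → Bool
tdinvPair m a x y = ltZ (rowRank m 3 a x) (rowRank m 3 a y) ∧ ltZ (rowRank m 3 a y) (rowRank m 3 a x ℤ.+ + m)

private
  ≤! : {m n : ℕ} {_ : T (m ≤ᵇ n)} → m ≤ n
  ≤! {m} {n} {m≤n} = ℕ.≤ᵇ⇒≤ m n m≤n

  Below : (ℕ → ℕ → Bool) → List ℕ → List ℕ → Set
  Below P w w* = pairSum P w ≤ pairSum P w*

  below₁₂ : ∀ P → P 1 0 ≡ false → P 2 0 ≡ false → P 2 1 ≡ false →
    Below P (1 ∷ 0 ∷ 2 ∷ []) (0 ∷ 1 ∷ 2 ∷ []) × Below P (1 ∷ 2 ∷ 0 ∷ []) (0 ∷ 1 ∷ 2 ∷ []) ×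
    Below P (0 ∷ 2 ∷ 1 ∷ []) (0 ∷ 1 ∷ 2 ∷ []) × Below P (2 ∷ 0 ∷ 1 ∷ []) (0 ∷ 1 ∷ 2 ∷ []) ×
    Below P (2 ∷ 1 ∷ 0 ∷ []) (0 ∷ 1 ∷ 2 ∷ [])
  below₁₂ P e₁ e₂ e₃ rewrite e₁ | e₂ | e₃ with P 0 1 | P 0 2 | P 1 2
  ... | true  | true  | true  = ≤! , ≤! , ≤! , ≤! , ≤!
  ... | true  | true  | false = ≤! , ≤! , ≤! , ≤! , ≤!
  ... | true  | false | true  = ≤! , ≤! , ≤! , ≤! , ≤!
  ... | true  | false | false = ≤! , ≤! , ≤! , ≤! , ≤!
  ... | false | true  | true  = ≤! , ≤! , ≤! , ≤! , ≤!
  ... | false | true  | false = ≤! , ≤! , ≤! , ≤! , ≤!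
  ... | false | false | true  = ≤! , ≤! , ≤! , ≤! , ≤!
  ... | false | false | false = ≤! , ≤! , ≤! , ≤! , ≤!

  below₂₁ : ∀ P → P 2 0 ≡ false → P 1 0 ≡ false → P 1 2 ≡ false →
    Below P (0 ∷ 1 ∷ 2 ∷ []) (0 ∷ 2 ∷ 1 ∷ []) × Below P (1 ∷ 0 ∷ 2 ∷ []) (0 ∷ 2 ∷ 1 ∷ []) ×
    Below P (1 ∷ 2 ∷ 0 ∷ []) (0 ∷ 2 ∷ 1 ∷ []) × Below P (2 ∷ 0 ∷ 1 ∷ []) (0 ∷ 2 ∷ 1 ∷ []) ×
    Below P (2 ∷ 1 ∷ 0 ∷ []) (0 ∷ 2 ∷ 1 ∷ [])
  below₂₁ P e₁ e₂ e₃ rewrite e₁ | e₂ | e₃ with P 0 2 | P 0 1 | P 2 1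
  ... | true  | true  | true  = ≤! , ≤! , ≤! , ≤! , ≤!
  ... | true  | true  | false = ≤! , ≤! , ≤! , ≤! , ≤!
  ... | true  | false | true  = ≤! , ≤! , ≤! , ≤! , ≤!
  ... | true  | false | false = ≤! , ≤! , ≤! , ≤! , ≤!
  ... | false | true  | true  = ≤! , ≤! , ≤! , ≤! , ≤!
  ... | false | true  | false = ≤! , ≤! , ≤! , ≤! , ≤!
  ... | false | false | true  = ≤! , ≤! , ≤! , ≤! , ≤!
  ... | false | false | false = ≤! , ≤! , ≤! , ≤! , ≤!

pairSum-sorted-maximal : ∀ P {u v} → RowOrder u v → P u 0 ≡ false → P v 0 ≡ false → P v u ≡ false →
  All (λ w → pairSum P w ≤ pairSum P (0 ∷ u ∷ v ∷ [])) (perms 3)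
pairSum-sorted-maximal P rows12 e₁ e₂ e₃ with below₁₂ P e₁ e₂ e₃
... | b₁ , b₂ , b₃ , b₄ , b₅ = ℕ.≤-refl ∷ b₁ ∷ b₂ ∷ b₃ ∷ b₄ ∷ b₅ ∷ []
pairSum-sorted-maximal P rows21 e₁ e₂ e₃ with below₂₁ P e₁ e₂ e₃
... | b₁ , b₂ , b₃ , b₄ , b₅ = b₁ ∷ b₂ ∷ b₃ ∷ ℕ.≤-refl ∷ b₄ ∷ b₅ ∷ []

pairSum-reversed : ∀ P {u v} → RowOrder u v → P u 0 ≡ false → P v 0 ≡ false → P v u ≡ false →
  pairSum P (v ∷ u ∷ 0 ∷ []) ≡ 0
pairSum-reversed P rows12 e₁ e₂ e₃ rewrite e₁ | e₂ | e₃ = refl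
pairSum-reversed P rows21 e₁ e₂ e₃ rewrite e₁ | e₂ | e₃ = refl

indicator : Bool → ℕ
indicator b = if b then 1 else 0

+-∸-cancel : ∀ p q → + (p + q) ℤ.- + q ≡ + p
+-∸-cancel p q = trans (ℤ.[+m]-[+n]≡m⊖n (p + q) q) (trans (ℤ.⊖-≥ (ℕ.m≤n+m q p)) (cong +_ (ℕ.m+n∸n≡m p q)))

dinv-of-maximal : ∀ m n a w → maxdinv m n a ≡ tdinv m n a w → dinv m n a w ≡ + pdinv m n a
dinv-of-maximal m n a w max≡ rewrite max≡ =
  trans (cong (λ k → + k ℤ.- + tdinv m n a w) (ℕ.+-comm (tdinv m n a w) (pdinv m n a)))
        (+-∸-cancel (pdinv m n a) (tdinv m n a w))

dinv-of-minimal : ∀ m n a w p → tdinv m n a w ≡ 0 → pdinv m n a ≡ p + maxdinv m n a → dinv m n a w ≡ + p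
dinv-of-minimal m n a w p min≡ pd≡ rewrite min≡ | pd≡ = +-∸-cancel p (maxdinv m n a)

module _ {m : ℕ} {a : List ℕ} {u v : ℕ} (o : RowOrder u v) (r : RanksIncrease m a u v) where

  private
    ρ : ℕ → ℤ
    ρ = rowRank m 3 a

    backward : ∀ {x y} → ρ y ℤ.< ρ x → tdinvPair m a x y ≡ false
    backward {x} {y} y<x = cong (_∧ ltZ (ρ y) (ρ x ℤ.+ + m)) (ltZ-false y<x)

    r₀ᵤ : ρ 0 ℤ.< ρ u
    r₀ᵤ = proj₁ r
    rᵤᵥ : ρ u ℤ.< ρ v
    rᵤᵥ = proj₂ r

  tdinv-reversed : tdinv m 3 a (v ∷ u ∷ 0 ∷ []) ≡ 0
  tdinv-reversed = pairSum-reversed (tdinvPair m a) o (backward r₀ᵤ) (backward (ℤ.<-trans r₀ᵤ rᵤᵥ)) (backward rᵤᵥ)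

  maxdinv-sorted : colIncreasing 3 a (0 ∷ u ∷ v ∷ []) ≡ true → maxdinv m 3 a ≡ tdinv m 3 a (0 ∷ u ∷ v ∷ [])
  maxdinv-sorted col = foldr-⊔-filterB-attained (tdinv m 3 a) (colIncreasing 3 a) (sorted∈perms o) col
    (pairSum-sorted-maximal (tdinvPair m a) o (backward r₀ᵤ) (backward (ℤ.<-trans r₀ᵤ rᵤᵥ)) (backward rᵤᵥ))
    where
    sorted∈perms : ∀ {u v} → RowOrder u v → (0 ∷ u ∷ v ∷ []) ∈ perms 3
    sorted∈perms rows12 = here refl
    sorted∈perms rows21 = there (there (there (here refl)))

tdinv-sorted : ∀ {m a u v} → RowOrder u v → RanksIncrease m a u v →
  rowRank m 3 a 1 ℤ.< rowRank m 3 a 0 ℤ.+ + m → rowRank m 3 a v ℤ.< rowRank m 3 a u ℤ.+ + m →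
  tdinv m 3 a (0 ∷ u ∷ v ∷ []) ≡ 2 + indicator (ltZ (rowRank m 3 a 2) (rowRank m 3 a 0 ℤ.+ + m))
tdinv-sorted {m} {a} rows12 (r₀₁ , r₁₂) near₀₁ near₁₂
  rewrite ltZ-true r₀₁ | ltZ-true near₀₁ | ltZ-true (ℤ.<-trans r₀₁ r₁₂) | ltZ-true r₁₂ | ltZ-true near₁₂
  with ltZ (rowRank m 3 a 2) (rowRank m 3 a 0 ℤ.+ + m)
... | true  = refl
... | false = refl
tdinv-sorted {m} {a} rows21 (r₀₂ , r₂₁) near₀₁ near₂₁
  rewrite ltZ-true r₀₂ | ltZ-true (ℤ.<-trans r₀₂ r₂₁) | ltZ-true near₀₁ | ltZ-true r₂₁ | ltZ-true near₂₁
  with ltZ (rowRank m 3 a 2) (rowRank m 3 a 0 ℤ.+ + m)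
... | true  = refl
... | false = refl

-- Ranks

-- cellRank M 3 x y = level + offset; the level is a multiple of gcd M 3 and the offset is below
-- it, so ranks compare by level first (multiple+offset-<).
level : ℕ → ℕ → ℕ → ℕ
level M x y = M * y ∸ 3 * x

offset : ℕ → ℕ → ℕ
offset M x = div (x * gcd M 3) M

cellRank-level : ∀ M x y → 3 * x ≤ M * y → cellRank M 3 x y ≡ + (level M x y + offset M x)
cellRank-level M x y h = cong (ℤ._+ + offset M x) (trans (ℤ.[+m]-[+n]≡m⊖n (M * y) (3 * x)) (ℤ.⊖-≥ h))

cellRank-origin : ∀ M → cellRank M 3 0 0 ≡ + 0
cellRank-origin zero = refl
cellRank-origin (suc M) rewrite ℕ.*-zeroʳ M = refl

cellRank-column : ∀ M₀ x {y y′} → y < y′ → cellRank (suc M₀) 3 x y ℤ.< cellRank (suc M₀) 3 x y′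
cellRank-column M₀ x y<y′ =
  ℤ.+-monoˡ-< (+ offset (suc M₀) x) (ℤ.+-monoˡ-< (ℤ.- + (3 * x)) (ℤ.+<+ (ℕ.*-monoʳ-< (suc M₀) y<y′)))

level-shift : ∀ m x y → level (3 + m) (y + x) y ≡ level m x y
level-shift m x y
  rewrite ℕ.*-distribʳ-+ y 3 m | ℕ.*-distribˡ-+ 3 y x = ℕ.[m+n]∸[m+o]≡n∸o (3 * y) (m * y) (3 * x)

row-shift : ∀ m x y → 3 * x ≤ m * y → 3 * (y + x) ≤ (3 + m) * y
row-shift m x y h rewrite ℕ.*-distribʳ-+ y 3 m | ℕ.*-distribˡ-+ 3 y x = ℕ.+-monoʳ-≤ (3 * y) h

row-unshift : ∀ m x y → 3 * (y + x) ≤ (3 + m) * y → 3 * x ≤ m * y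
row-unshift m x y h rewrite ℕ.*-distribʳ-+ y 3 m | ℕ.*-distribˡ-+ 3 y x = ℕ.+-cancelˡ-≤ (3 * y) _ _ h

3*x+level : ∀ M x y → 3 * x ≤ M * y → 3 * x + level M x y ≡ M * y
3*x+level M x y = ℕ.m+[n∸m]≡n

gcd[3+m,3]≡gcd[m,3] : ∀ m → gcd (3 + m) 3 ≡ gcd m 3
gcd[3+m,3]≡gcd[m,3] m = ∣-antisym
  (gcd-greatest (∣m+n∣m⇒∣n (gcd[m,n]∣m (3 + m) 3) (gcd[m,n]∣n (3 + m) 3)) (gcd[m,n]∣n (3 + m) 3))
  (gcd-greatest (∣m∣n⇒∣m+n (gcd[m,n]∣n m 3) (gcd[m,n]∣m m 3)) (gcd[m,n]∣n m 3))

gcd[m,3]≡3 : ∀ {m} → 3 ∣ m → gcd m 3 ≡ 3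
gcd[m,3]≡3 {m} 3∣m = ∣-antisym (gcd[m,n]∣n m 3) (gcd-greatest 3∣m ∣-refl)

multiple+offset-< : ∀ {d A B e e′} → d ∣ A → d ∣ B → A < B → e < d → A + e < B + e′
multiple+offset-< {d} {A} {B} {e} {e′} d∣A d∣B A<B e<d = begin-strict
  A + e             <⟨ ℕ.+-monoʳ-< A e<d ⟩
  A + d             ≤⟨ ℕ.+-monoʳ-≤ A (∣⇒≤ ⦃ gap≢0 ⦄ d∣gap) ⟩
  A + (B ∸ A)       ≡⟨ ℕ.m+[n∸m]≡n (ℕ.<⇒≤ A<B) ⟩
  B                 ≤⟨ ℕ.m≤m+n B e′ ⟩
  B + e′            ∎
  where
  open ℕ.≤-Reasoning
  d∣gap : d ∣ B ∸ A
  d∣gap = ∣m+n∣m⇒∣n (subst (d ∣_) (sym (ℕ.m+[n∸m]≡n (ℕ.<⇒≤ A<B))) d∣B) d∣A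
  gap≢0 : NonZero (B ∸ A)
  gap≢0 = ℕ.>-nonZero (ℕ.m<n⇒0<n∸m A<B)

module _ (M x : ℕ) where

  offset-< : x < suc M → offset (suc M) x < gcd (suc M) 3
  offset-< x<M = m<n*o⇒m/o<n (subst (x * g <_) (ℕ.*-comm (suc M) g) (ℕ.*-monoˡ-< g ⦃ g≢0 ⦄ x<M))
    where
    g : ℕ
    g = gcd (suc M) 3
    g≢0 : NonZero g
    g≢0 = ℕ.≢-nonZero (gcd[m,n]≢0 (suc M) 3 (inj₂ (λ ())))

  offset-positive : 3 ∣ suc M → suc M ≤ 3 * x → 0 < offset (suc M) x
  offset-positive 3∣M M≤3x rewrite gcd[m,3]≡3 3∣M = m≥n⇒m/n>0 (subst (suc M ≤_) (ℕ.*-comm 3 x) M≤3x)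

  offset-step : ∀ x′ → 3 ∣ suc M → 3 * x′ ≡ 3 * x + suc M → offset (suc M) x′ ≡ suc (offset (suc M) x)
  offset-step x′ 3∣M eq rewrite gcd[m,3]≡3 3∣M = begin
    x′ * 3 / suc M                    ≡⟨ cong (_/ suc M) x′*3≡ ⟩
    (x * 3 + suc M) / suc M           ≡⟨ +-distrib-/-∣ʳ (x * 3) ∣-refl ⟩
    x * 3 / suc M + suc M / suc M     ≡⟨ cong (_+_ (x * 3 / suc M)) (n/n≡1 (suc M)) ⟩
    x * 3 / suc M + 1                 ≡⟨ ℕ.+-comm _ 1 ⟩
    suc (x * 3 / suc M)               ∎
    where
    open ≡-Reasoning
    x′*3≡ : x′ * 3 ≡ x * 3 + suc M
    x′*3≡ = trans (ℕ.*-comm x′ 3) (trans eq (cong (_+ suc M) (ℕ.*-comm 3 x)))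

-- Cars stacked in one column carry increasing labels and increasing ranks, so every
-- labelling of such a path has an ascent.
pathWeight-3-column₀₁ : ∀ M₀ i j z → pathWeight (suc M₀) 3 (3 ∷ []) i j (path₃ 0 z) ≡ + 0
pathWeight-3-column₀₁ M₀ i j z = pathWeight-unique-labelling (suc M₀) (3 ∷ []) i j (path₃ 0 z) 0 5
  (  weight-3-ascent₁  {0} {1} {2} r₀₁
  ∷ labelWeight-column-violated {1 ∷ 0 ∷ 2 ∷ []} (here refl) refl (s≤s z≤n)
  ∷ labelWeight-column-violated {1 ∷ 2 ∷ 0 ∷ []} (there (here refl)) refl (s≤s z≤n)
  ∷ weight-3-ascent₀₂ {0} {2} {1} r₀₁
  ∷ weight-3-ascent₂  {2} {0} {1} r₀₁
  ∷ labelWeight-column-violated {2 ∷ 1 ∷ 0 ∷ []} (there (there (here refl))) refl (s≤s z≤n) ∷ [])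
  where
  open LabelWeights (suc M₀) i j (path₃ 0 z)
  open ColumnClash (suc M₀) (3 ∷ []) i j (path₃ 0 z)
  r₀₁ : rowRank (suc M₀) 3 (path₃ 0 z) 0 ℤ.< rowRank (suc M₀) 3 (path₃ 0 z) 1
  r₀₁ = cellRank-column M₀ 0 (s≤s z≤n)

pathWeight-3-column₁₂ : ∀ M₀ i j z → pathWeight (suc M₀) 3 (3 ∷ []) i j (path₃ z z) ≡ + 0
pathWeight-3-column₁₂ M₀ i j z = pathWeight-unique-labelling (suc M₀) (3 ∷ []) i j (path₃ z z) 0 5
  (  weight-3-ascent₂  {0} {1} {2} r₁₂
  ∷ weight-3-ascent₀₂ {1} {0} {2} r₁₂
  ∷ weight-3-ascent₁  {1} {2} {0} r₁₂
  ∷ labelWeight-column-violated {0 ∷ 2 ∷ 1 ∷ []} (there (there (here refl))) refl (s≤s (s≤s z≤n))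
  ∷ labelWeight-column-violated {2 ∷ 0 ∷ 1 ∷ []} (there (here refl)) refl (s≤s (s≤s z≤n))
  ∷ labelWeight-column-violated {2 ∷ 1 ∷ 0 ∷ []} (here refl) refl (s≤s (s≤s z≤n)) ∷ [])
  where
  open LabelWeights (suc M₀) i j (path₃ z z)
  open ColumnClash (suc M₀) (3 ∷ []) i j (path₃ z z)
  r₁₂ : rowRank (suc M₀) 3 (path₃ z z) 1 ℤ.< rowRank (suc M₀) 3 (path₃ z z) 2
  r₁₂ = cellRank-column M₀ z (s≤s (s≤s z≤n))

record ShiftOrder (m x₁ x₂ : ℕ) : Set where
  field
    {u v}     : ℕ
    order     : RowOrder u v
    ranks     : RanksIncrease m (path₃ x₁ x₂) u v
    ranks′    : RanksIncrease (3 + m) (path₃ (1 + x₁) (2 + x₂)) u v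
    sortedCol : colIncreasing 3 (path₃ x₁ x₂) (0 ∷ u ∷ v ∷ []) ≡ true

0<level+offset : ∀ A e → (A ≡ 0 → 0 < e) → 0 < A + e
0<level+offset zero    e h = h refl
0<level+offset (suc A) e h = s≤s z≤n

-- a and its shift b share the levels Aᵧ of their rows y = 1, 2; their offsets are eᵧ and eᵧ′.
module ShiftedPath (m₀ x₁ x₂ : ℕ) (dyck : Dyck₃ (suc m₀) x₁ x₂) where

  m : ℕ
  m = suc m₀

  a b : List ℕ
  a = path₃ x₁ x₂
  b = path₃ (1 + x₁) (2 + x₂)

  x₁≤x₂ : x₁ ≤ x₂
  x₁≤x₂ = Dyck₃.monotone dyck

  private
    row₁ : 3 * x₁ ≤ m * 1
    row₁ = Dyck₃.row₁ dyck
    row₂ : 3 * x₂ ≤ m * 2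
    row₂ = Dyck₃.row₂ dyck

    d A₁ A₂ e₁ e₂ e₁′ e₂′ : ℕ
    d   = gcd m 3
    A₁  = level m x₁ 1
    A₂  = level m x₂ 2
    e₁  = offset m x₁
    e₂  = offset m x₂
    e₁′ = offset (3 + m) (1 + x₁)
    e₂′ = offset (3 + m) (2 + x₂)

    rank₀ : rowRank m 3 a 0 ≡ + 0
    rank₀ = cellRank-origin m
    rank₁ : rowRank m 3 a 1 ≡ + (A₁ + e₁)
    rank₁ = cellRank-level m x₁ 1 row₁
    rank₂ : rowRank m 3 a 2 ≡ + (A₂ + e₂)
    rank₂ = cellRank-level m x₂ 2 row₂
    rank₀′ : rowRank (3 + m) 3 b 0 ≡ + 0
    rank₀′ = cellRank-origin (3 + m)
    rank₁′ : rowRank (3 + m) 3 b 1 ≡ + (A₁ + e₁′)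
    rank₁′ = trans (cellRank-level (3 + m) (1 + x₁) 1 (row-shift m x₁ 1 row₁))
                   (cong (λ A → + (A + e₁′)) (level-shift m x₁ 1))
    rank₂′ : rowRank (3 + m) 3 b 2 ≡ + (A₂ + e₂′)
    rank₂′ = trans (cellRank-level (3 + m) (2 + x₂) 2 (row-shift m x₂ 2 row₂))
                   (cong (λ A → + (A + e₂′)) (level-shift m x₂ 2))

    x<m : ∀ {x y} → y ≤ 2 → 3 * x ≤ m * y → x < m
    x<m {x} {y} y≤2 h = ℕ.*-cancelˡ-< 3 x m (ℕ.≤-<-trans h (ℕ.≤-<-trans (ℕ.*-monoʳ-≤ m y≤2)
      (subst (m * 2 <_) (ℕ.*-comm m 3) (ℕ.*-monoʳ-< m (s≤s (s≤s (s≤s z≤n)))))))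

    x₁<m : x₁ < m
    x₁<m = x<m (s≤s z≤n) row₁
    x₂<m : x₂ < m
    x₂<m = x<m ℕ.≤-refl row₂

    d≤3 : d ≤ 3
    d≤3 = gcd[m,n]≤n m 3

    d≡gcd′ : gcd (3 + m) 3 ≡ d
    d≡gcd′ = gcd[3+m,3]≡gcd[m,3] m

    e₁<d : e₁ < d
    e₁<d = offset-< m₀ x₁ x₁<m
    e₂<d : e₂ < d
    e₂<d = offset-< m₀ x₂ x₂<m
    e₁′<d : e₁′ < d
    e₁′<d = subst (e₁′ <_) d≡gcd′ (offset-< (3 + m₀) (1 + x₁) (s≤s (ℕ.≤-trans x₁<m (ℕ.m≤n+m m 2))))
    e₂′<d : e₂′ < d
    e₂′<d = subst (e₂′ <_) d≡gcd′ (offset-< (3 + m₀) (2 + x₂) (s≤s (s≤s (ℕ.≤-trans x₂<m (ℕ.m≤n+m m 1)))))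

    d∣level : ∀ x y → 3 * x ≤ m * y → d ∣ level m x y
    d∣level x y h = ∣m+n∣m⇒∣n (subst (d ∣_) (sym (3*x+level m x y h)) (∣-trans (gcd[m,n]∣m m 3) (m∣m*n y)))
                                   (∣-trans (gcd[m,n]∣n m 3) (m∣m*n x))

    d∣3+m : d ∣ 3 + m
    d∣3+m = ∣m∣n⇒∣m+n (gcd[m,n]∣n m 3) (gcd[m,n]∣m m 3)

    fill₁ : 3 * x₁ + A₁ ≡ m * 1
    fill₁ = 3*x+level m x₁ 1 row₁
    fill₂ : 3 * x₂ + A₂ ≡ m * 2
    fill₂ = 3*x+level m x₂ 2 row₂

    3∣3+m : 3 ∣ m → 3 ∣ 3 + m
    3∣3+m = ∣m∣n⇒∣m+n ∣-refl

    vanishing-row₁ : A₁ ≡ 0 → 0 < e₁ × 0 < e₁′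
    vanishing-row₁ A₁≡0 = offset-positive m₀ x₁ 3∣m m≤3x₁ , offset-positive (3 + m₀) (1 + x₁) (3∣3+m 3∣m) m+3≤
      where
      3x₁≡m : 3 * x₁ ≡ m
      3x₁≡m = trans (sym (ℕ.+-identityʳ _)) (trans (cong (_+_ (3 * x₁)) (sym A₁≡0)) (trans fill₁ (ℕ.*-identityʳ m)))
      3∣m : 3 ∣ m
      3∣m = divides x₁ (trans (sym 3x₁≡m) (ℕ.*-comm 3 x₁))
      m≤3x₁ : m ≤ 3 * x₁
      m≤3x₁ = ℕ.≤-reflexive (sym 3x₁≡m)
      m+3≤ : 3 + m ≤ 3 * (1 + x₁)
      m+3≤ = subst (3 + m ≤_) (sym (ℕ.*-distribˡ-+ 3 1 x₁)) (ℕ.+-monoʳ-≤ 3 m≤3x₁)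

    vanishing-row₂ : A₂ ≡ 0 → 0 < e₂ × 0 < e₂′
    vanishing-row₂ A₂≡0 = offset-positive m₀ x₂ 3∣m m≤3x₂ , offset-positive (3 + m₀) (2 + x₂) (3∣3+m 3∣m) m+3≤
      where
      3x₂≡2m : 3 * x₂ ≡ m * 2
      3x₂≡2m = trans (sym (ℕ.+-identityʳ _)) (trans (cong (_+_ (3 * x₂)) (sym A₂≡0)) fill₂)
      3∣m : 3 ∣ m
      3∣m = ∣m+n∣m⇒∣n (subst (3 ∣_) (m*3≡m*2+m m) (n∣m*n m)) (divides x₂ (trans (sym 3x₂≡2m) (ℕ.*-comm 3 x₂)))
        where
        m*3≡m*2+m : ∀ m → m * 3 ≡ m * 2 + m
        m*3≡m*2+m = solve-∀
      m≤3x₂ : m ≤ 3 * x₂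
      m≤3x₂ = subst (m ≤_) (sym 3x₂≡2m) (ℕ.m≤m*n m 2)
      m+3≤ : 3 + m ≤ 3 * (2 + x₂)
      m+3≤ = subst (3 + m ≤_) (sym (ℕ.*-distribˡ-+ 3 2 x₂)) (ℕ.+-mono-≤ {3} {6} (s≤s (s≤s (s≤s z≤n))) m≤3x₂)

    equal-levels : A₁ ≡ A₂ → e₂ ≡ suc e₁ × e₂′ ≡ suc e₁′
    equal-levels A₁≡A₂ = offset-step m₀ x₁ x₂ 3∣m 3x₂≡ , offset-step (3 + m₀) (1 + x₁) (2 + x₂) (3∣3+m 3∣m) 3x₂≡′
      where
      3x₂≡ : 3 * x₂ ≡ 3 * x₁ + m
      3x₂≡ = ℕ.+-cancelʳ-≡ A₂ (3 * x₂) (3 * x₁ + m) (begin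
        3 * x₂ + A₂         ≡⟨ fill₂ ⟩
        m * 2               ≡⟨ ℕ.*-suc m 1 ⟩
        m + m * 1           ≡⟨ cong (_+_ m) (sym fill₁) ⟩
        m + (3 * x₁ + A₁)   ≡⟨ cong (λ A → m + (3 * x₁ + A)) A₁≡A₂ ⟩
        m + (3 * x₁ + A₂)   ≡⟨ rearrange m (3 * x₁) A₂ ⟩
        3 * x₁ + m + A₂     ∎)
        where
        open ≡-Reasoning
        rearrange : ∀ m p A → m + (p + A) ≡ p + m + A
        rearrange = solve-∀
      3∣m : 3 ∣ m
      3∣m = ∣m+n∣m⇒∣n (subst (3 ∣_) 3x₂≡ (m∣m*n x₂)) (m∣m*n x₁)
      3x₂≡′ : 3 * (2 + x₂) ≡ 3 * (1 + x₁) + (3 + m)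
      3x₂≡′ = begin
        3 * (2 + x₂)              ≡⟨ ℕ.*-distribˡ-+ 3 2 x₂ ⟩
        6 + 3 * x₂                ≡⟨ cong (_+_ 6) 3x₂≡ ⟩
        6 + (3 * x₁ + m)          ≡⟨ rearrange (3 * x₁) m ⟩
        (3 + 3 * x₁) + (3 + m)    ≡⟨ cong (_+ (3 + m)) (sym (ℕ.*-distribˡ-+ 3 1 x₁)) ⟩
        3 * (1 + x₁) + (3 + m)    ∎
        where
        open ≡-Reasoning
        rearrange : ∀ p m → 6 + (p + m) ≡ (3 + p) + (3 + m)
        rearrange = solve-∀

    ranks-from-ℕ : ∀ {ρ₀ ρᵤ ρᵥ : ℤ} {p q} → ρ₀ ≡ + 0 → ρᵤ ≡ + p → ρᵥ ≡ + q → 0 < p → p < q → ρ₀ ℤ.< ρᵤ × ρᵤ ℤ.< ρᵥ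
    ranks-from-ℕ refl refl refl 0<p p<q = ℤ.+<+ 0<p , ℤ.+<+ p<q

    positive₁ : 0 < A₁ + e₁ × 0 < A₁ + e₁′
    positive₁ = 0<level+offset A₁ e₁ (proj₁ ∘ vanishing-row₁) , 0<level+offset A₁ e₁′ (proj₂ ∘ vanishing-row₁)
    positive₂ : 0 < A₂ + e₂ × 0 < A₂ + e₂′
    positive₂ = 0<level+offset A₂ e₂ (proj₁ ∘ vanishing-row₂) , 0<level+offset A₂ e₂′ (proj₂ ∘ vanishing-row₂)

    ordered₁₂ : ∀ {e e′} → A₁ < A₂ → e < d → A₁ + e < A₂ + e′
    ordered₁₂ {e} {e′} = multiple+offset-< {d} {A₁} {A₂} {e} {e′} (d∣level x₁ 1 row₁) (d∣level x₂ 2 row₂)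
    ordered₂₁ : ∀ {e e′} → A₂ < A₁ → e < d → A₂ + e < A₁ + e′
    ordered₂₁ {e} {e′} = multiple+offset-< {d} {A₂} {A₁} {e} {e′} (d∣level x₂ 2 row₂) (d∣level x₁ 1 row₁)

    ≢-of-lower-level₂ : A₂ < A₁ → ¬ x₁ ≡ x₂
    ≢-of-lower-level₂ A₂<A₁ refl = ℕ.<⇒≱ A₂<A₁ (ℕ.∸-monoˡ-≤ (3 * x₁) (ℕ.*-monoʳ-≤ m (s≤s z≤n)))

  shiftOrder : ShiftOrder m x₁ x₂
  shiftOrder with ℕ.<-cmp A₁ A₂
  ... | tri< A₁<A₂ _ _ = record
    { order     = rows12
    ; ranks     = ranks-from-ℕ rank₀ rank₁ rank₂ (proj₁ positive₁) (ordered₁₂ A₁<A₂ e₁<d)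
    ; ranks′    = ranks-from-ℕ rank₀′ rank₁′ rank₂′ (proj₂ positive₁) (ordered₁₂ A₁<A₂ e₁′<d)
    ; sortedCol = colIncreasing-012 x₁ x₂ }
  ... | tri≈ _ A₁≡A₂ _ = record
    { order     = rows12
    ; ranks     = ranks-from-ℕ rank₀ rank₁ rank₂ (proj₁ positive₁) (step e₁ e₂ (proj₁ (equal-levels A₁≡A₂)))
    ; ranks′    = ranks-from-ℕ rank₀′ rank₁′ rank₂′ (proj₂ positive₁) (step e₁′ e₂′ (proj₂ (equal-levels A₁≡A₂)))
    ; sortedCol = colIncreasing-012 x₁ x₂ }
    where
    step : ∀ e e′ → e′ ≡ suc e → A₁ + e < A₂ + e′
    step e e′ e′≡ rewrite A₁≡A₂ | e′≡ = ℕ.+-monoʳ-< A₂ (ℕ.n<1+n e)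
  ... | tri> _ _ A₂<A₁ = record
    { order     = rows21
    ; ranks     = ranks-from-ℕ rank₀ rank₂ rank₁ (proj₁ positive₂) (ordered₂₁ A₂<A₁ e₂<d)
    ; ranks′    = ranks-from-ℕ rank₀′ rank₂′ rank₁′ (proj₂ positive₂) (ordered₂₁ A₂<A₁ e₂′<d)
    ; sortedCol = colIncreasing-021 (≢-of-lower-level₂ A₂<A₁) }

  private
    offset<3 : ∀ {e} → e < d → e < 3
    offset<3 e<d = ℕ.<-≤-trans e<d d≤3

    A₁+e₁′<3+m : A₁ + e₁′ < 3 + m
    A₁+e₁′<3+m = subst (A₁ + e₁′ <_) (ℕ.+-comm m 3)
      (ℕ.+-mono-≤-< (subst (A₁ ≤_) (ℕ.*-identityʳ m) (ℕ.m∸n≤m (m * 1) (3 * x₁))) (offset<3 e₁′<d))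

    A₂≤A₁+m : A₂ ≤ A₁ + m
    A₂≤A₁+m = begin
      m * 2 ∸ 3 * x₂        ≤⟨ ℕ.∸-monoʳ-≤ (m * 2) (ℕ.*-monoʳ-≤ 3 x₁≤x₂) ⟩
      m * 2 ∸ 3 * x₁        ≡⟨ cong (_∸ 3 * x₁) (ℕ.*-suc m 1) ⟩
      (m + m * 1) ∸ 3 * x₁  ≡⟨ ℕ.+-∸-assoc m row₁ ⟩
      m + A₁                ≡⟨ ℕ.+-comm m A₁ ⟩
      A₁ + m                ∎
      where open ℕ.≤-Reasoning

    A₂<3+m⇔ : A₂ < 3 + m ⇔ (3 + m) * 1 < 3 * (2 + x₂)
    A₂<3+m⇔ = mk⇔
      (λ A₂< → subst₂ _<_ (sym (eq₃ m)) (sym (eq₄ x₂)) (ℕ.+-monoʳ-< 3 (ℕ.+-cancelˡ-< m m (3 * x₂ + 3)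
        (subst₂ _<_ (trans fill₂ (eq₁ m)) (eq₂ m x₂) (ℕ.+-monoʳ-< (3 * x₂) A₂<)))))
      (λ <3*[2+x₂] → ℕ.+-cancelˡ-< (3 * x₂) A₂ (3 + m)
        (subst₂ _<_ (sym (trans fill₂ (eq₁ m))) (sym (eq₂ m x₂)) (ℕ.+-monoʳ-< m
          (ℕ.+-cancelˡ-< 3 m (3 * x₂ + 3) (subst₂ _<_ (eq₃ m) (eq₄ x₂) <3*[2+x₂])))))
      where
      eq₁ : ∀ m → m * 2 ≡ m + m
      eq₁ = solve-∀
      eq₂ : ∀ m x → 3 * x + (3 + m) ≡ m + (3 * x + 3)
      eq₂ = solve-∀
      eq₃ : ∀ m → (3 + m) * 1 ≡ 3 + m
      eq₃ = solve-∀
      eq₄ : ∀ x → 3 * (2 + x) ≡ 3 + (3 * x + 3)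
      eq₄ = solve-∀

    near-from-ℕ : ∀ {x y : ℤ} {p q r} → x ≡ + p → y ≡ + q → p < q + r → x ℤ.< y ℤ.+ + r
    near-from-ℕ refl refl p<q+r = ℤ.+<+ p<q+r

  row₁-near-row₀′ : rowRank (3 + m) 3 b 1 ℤ.< rowRank (3 + m) 3 b 0 ℤ.+ + (3 + m)
  row₁-near-row₀′ = near-from-ℕ rank₁′ rank₀′ A₁+e₁′<3+m

  rowᵥ-near-rowᵤ′ : ∀ {u v} → RowOrder u v → rowRank (3 + m) 3 b v ℤ.< rowRank (3 + m) 3 b u ℤ.+ + (3 + m)
  rowᵥ-near-rowᵤ′ rows12 = near-from-ℕ rank₂′ rank₁′ (begin-strict
    A₂ + e₂′               <⟨ ℕ.+-monoʳ-< A₂ (offset<3 e₂′<d) ⟩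
    A₂ + 3                 ≤⟨ ℕ.+-monoˡ-≤ 3 A₂≤A₁+m ⟩
    A₁ + m + 3             ≡⟨ trans (ℕ.+-assoc A₁ m 3) (cong (_+_ A₁) (ℕ.+-comm m 3)) ⟩
    A₁ + (3 + m)           ≤⟨ ℕ.+-monoˡ-≤ (3 + m) (ℕ.m≤m+n A₁ e₁′) ⟩
    A₁ + e₁′ + (3 + m)     ∎)
    where open ℕ.≤-Reasoning
  rowᵥ-near-rowᵤ′ rows21 = near-from-ℕ rank₁′ rank₂′ (ℕ.<-≤-trans A₁+e₁′<3+m (ℕ.m≤n+m (3 + m) (A₂ + e₂′)))

  -- Both sides say A₂ < 3 + m; the right-hand side is the pdinv test of the cell (0,2) of λ(b).
  corner′ : ltZ (rowRank (3 + m) 3 b 2) (rowRank (3 + m) 3 b 0 ℤ.+ + (3 + m)) ≡ ((3 + m) * 1 <ᵇ 3 * (2 + x₂))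
  corner′ = trans (cong₂ ltZ rank₂′ (cong (ℤ._+ + (3 + m)) rank₀′))
    (does-⇔ (mk⇔ to from) (+ (A₂ + e₂′) ℤ.<? + (3 + m)) ((3 + m) * 1 ℕ.<? 3 * (2 + x₂)))
    where
    to : + (A₂ + e₂′) ℤ.< + (3 + m) → (3 + m) * 1 < 3 * (2 + x₂)
    to r = Equivalence.to A₂<3+m⇔ (ℕ.≤-<-trans (ℕ.m≤m+n A₂ e₂′) (ℤ.drop‿+<+ r))
    from : (3 + m) * 1 < 3 * (2 + x₂) → + (A₂ + e₂′) ℤ.< + (3 + m)
    from r = ℤ.+<+ (subst (A₂ + e₂′ <_) (ℕ.+-identityʳ (3 + m))
      (multiple+offset-< {d} {A₂} {3 + m} {e₂′} {0} (d∣level x₂ 2 row₂) d∣3+m (Equivalence.from A₂<3+m⇔ r) e₂′<d))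

-- area, ret and pdinv of the shifted path

area-shift : ∀ m x₁ x₂ → area (3 + m) 3 (path₃ (1 + x₁) (2 + x₂)) ≡ area m 3 (path₃ x₁ x₂)
area-shift m x₁ x₂
  rewrite +-distrib-/-∣ˡ {3} (m * 1) {3} (divides 1 refl) | +-distrib-/-∣ˡ {6} (m * 2) {3} (divides 2 refl) = refl

ret-via : ∀ M a {d} → gcd M 3 ≡ d →
  ret M 3 a ≡ firstOr d (λ i → through M 3 a (i * div M d) (i * div 3 d)) (applyUpTo suc d)
ret-via M a refl = refl

gcd[m,3]≡1⊎3 : ∀ m → gcd m 3 ≡ 1 ⊎ gcd m 3 ≡ 3
gcd[m,3]≡1⊎3 m = prime⇒irreducible (from-yes (prime? 3)) (gcd[m,n]∣n m 3)

ret-coprime : ∀ M a → gcd M 3 ≡ 1 → ret M 3 a ≡ 1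
ret-coprime M a g = trans (ret-via M a g) (if-eta _)

<ᵇ-suc : ∀ x y → (x <ᵇ suc y) ≡ (x ≤ᵇ y)
<ᵇ-suc zero    y = refl
<ᵇ-suc (suc x) y = refl

firstOr-3 : ∀ p → firstOr 3 p (applyUpTo suc 3) ≡ (if p 1 then 1 else if p 2 then 2 else 3)
firstOr-3 p = cong (λ r → if p 1 then 1 else if p 2 then 2 else r) (if-eta (p 3))

ret-shift-multiple-of-3 : ∀ k x₁ x₂ → x₁ ≤ k →
  ret (3 + k * 3) 3 (path₃ (1 + x₁) (2 + x₂)) ≡ ret (k * 3) 3 (path₃ x₁ x₂)
ret-shift-multiple-of-3 k x₁ x₂ x₁≤k = begin
  ret (3 + k * 3) 3 b              ≡⟨ ret-via (3 + k * 3) b (gcd[m,3]≡3 (divides (suc k) refl)) ⟩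
  firstOr 3 (through′ b (3 + k * 3)) (applyUpTo suc 3)  ≡⟨ firstOr-3 (through′ b (3 + k * 3)) ⟩
  _                                ≡⟨ cong₂ (λ c₁ c₂ → if c₁ then 1 else if c₂ then 2 else 3) first second ⟩
  _                                ≡⟨ sym (firstOr-3 (through′ a (k * 3))) ⟩
  firstOr 3 (through′ a (k * 3)) (applyUpTo suc 3)      ≡⟨ sym (ret-via (k * 3) a (gcd[m,3]≡3 (divides k refl))) ⟩
  ret (k * 3) 3 a                  ∎
  where
  open ≡-Reasoning
  a b : List ℕ
  a = path₃ x₁ x₂
  b = path₃ (1 + x₁) (2 + x₂)
  through′ : List ℕ → ℕ → ℕ → Bool
  through′ c M i = through M 3 c (i * div M 3) (i * div 3 3)
  first : through′ b (3 + k * 3) 1 ≡ through′ a (k * 3) 1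
  first rewrite m*n/n≡m (suc k) 3 ⦃ _ ⦄ | m*n/n≡m k 3 ⦃ _ ⦄ = <ᵇ-suc (k + 0) x₁
  second : through′ b (3 + k * 3) 2 ≡ through′ a (k * 3) 2
  second rewrite m*n/n≡m (suc k) 3 ⦃ _ ⦄ | m*n/n≡m k 3 ⦃ _ ⦄ =
    cong₂ _∧_ (trans (dec-true (x₁ ℕ.<? 2 * suc k) x₁<2[1+k]) (sym (dec-true (x₁ ℕ.≤? 2 * k) x₁≤2k)))
              (trans (cong (_≤ᵇ 2 + x₂) (ℕ.*-suc 2 k)) (<ᵇ-suc (2 * k) x₂))
    where
    x₁≤2k : x₁ ≤ 2 * k
    x₁≤2k = ℕ.≤-trans x₁≤k (ℕ.m≤n*m k 2)
    x₁<2[1+k] : x₁ < 2 * suc k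
    x₁<2[1+k] = ℕ.≤-trans (s≤s x₁≤k) (ℕ.m≤n*m (suc k) 2)

ret-shift : ∀ m x₁ x₂ → Dyck₃ m x₁ x₂ → ret (3 + m) 3 (path₃ (1 + x₁) (2 + x₂)) ≡ ret m 3 (path₃ x₁ x₂)
ret-shift m x₁ x₂ (dyck₃ _ row₁ _) with gcd[m,3]≡1⊎3 m
... | inj₁ g = trans (ret-coprime (3 + m) _ (trans (gcd[3+m,3]≡gcd[m,3] m) g)) (sym (ret-coprime m _ g))
... | inj₂ g with subst (_∣ m) g (gcd[m,n]∣m m 3)
...   | divides k refl = ret-shift-multiple-of-3 k x₁ x₂
        (ℕ.*-cancelˡ-≤ 3 (subst (3 * x₁ ≤_) (trans (ℕ.*-identityʳ (k * 3)) (ℕ.*-comm k 3)) row₁))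

countBelow : ℕ → (ℕ → Bool) → ℕ
countBelow zero    p = 0
countBelow (suc k) p = indicator (p 0) + countBelow k (p ∘ suc)

count-applyUpTo : ∀ (p : ℕ → Bool) f k → count p (applyUpTo f k) ≡ countBelow k (p ∘ f)
count-applyUpTo p f zero    = refl
count-applyUpTo p f (suc k) with p (f 0)
... | true  = cong suc (count-applyUpTo p (f ∘ suc) k)
... | false = count-applyUpTo p (f ∘ suc) k

countBelow-cong : ∀ k {p q : ℕ → Bool} → (∀ i → i < k → p i ≡ q i) → countBelow k p ≡ countBelow k q
countBelow-cong zero    eq = refl
countBelow-cong (suc k) eq =
  cong₂ _+_ (cong indicator (eq 0 (s≤s z≤n))) (countBelow-cong k (λ i i<k → eq (suc i) (s≤s i<k)))

countBelow-all : ∀ k {p : ℕ → Bool} → (∀ i → i < k → p i ≡ true) → countBelow k p ≡ k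
countBelow-all zero    all = refl
countBelow-all (suc k) all rewrite all 0 (s≤s z≤n) = cong suc (countBelow-all k (λ i i<k → all (suc i) (s≤s i<k)))

countBelow-suc : ∀ k (p : ℕ → Bool) → countBelow (suc k) p ≡ countBelow k p + indicator (p k)
countBelow-suc zero    p = ℕ.+-comm (indicator (p 0)) 0
countBelow-suc (suc k) p =
  trans (cong (_+_ (indicator (p 0))) (countBelow-suc k (p ∘ suc))) (sym (ℕ.+-assoc (indicator (p 0)) _ _))

cellCondition : ℕ → ℕ → ℕ → Bool
cellCondition M arm leg = (arm * 3 ≤ᵇ M * suc leg) ∧ ((leg ≡ᵇ 0) ∨ (M * leg <ᵇ 3 * suc arm))

legOf : Bool → ℕ
legOf c = length (if c then 1 ∷ [] else [])

cellCondition-shift : ∀ m arm c → 3 * arm ≤ m * 2 →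
  cellCondition (3 + m) (suc arm) (legOf c) ≡ cellCondition m arm (legOf c)
cellCondition-shift m arm false h = cong (_∧ true) (<ᵇ-suc (arm * 3) (m * 1))
cellCondition-shift m arm true  h =
  cong₂ _∧_ (trans (dec-true (suc arm * 3 ℕ.≤? (3 + m) * 2) h′) (sym (dec-true (arm * 3 ℕ.≤? m * 2) h″)))
            (cong ((3 + m * 1) <ᵇ_) (ℕ.*-suc 3 (suc arm)))
  where
  h″ : arm * 3 ≤ m * 2
  h″ = subst (_≤ m * 2) (ℕ.*-comm 3 arm) h
  h′ : suc arm * 3 ≤ (3 + m) * 2
  h′ = ℕ.+-mono-≤ (ℕ.m≤m+n 3 3) h″

∸-pred : ∀ {x i} → i < x → x ∸ i ≡ suc (x ∸ suc i)
∸-pred {suc x} {zero}  _           = refl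
∸-pred {suc x} {suc i} (s≤s i<x)   = ∸-pred i<x

pdinv-row₁ : ∀ M x₁ x₂ → 3 * x₁ ≤ M * 1 → count (λ x → pdinvCell M 3 (path₃ x₁ x₂) x 1) (upTo x₁) ≡ x₁
pdinv-row₁ M x₁ x₂ h = trans (count-applyUpTo _ (λ i → i) x₁) (countBelow-all x₁ λ i _ →
  cong (_∧ true) (dec-true ((x₁ ∸ suc i) * 3 ℕ.≤? M * 1)
    (ℕ.≤-trans (ℕ.*-monoˡ-≤ 3 (ℕ.m∸n≤m x₁ (suc i))) (subst (_≤ M * 1) (ℕ.*-comm 3 x₁) h))))

-- Compared with λ(a), λ(b) has one more cell in row 1 and two more in row 2, the cell (0,2) and
-- the last one; the other cells keep their leg and grow their arm by one.
pdinv-shift : ∀ m x₁ x₂ → Dyck₃ m x₁ x₂ →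
  pdinv (3 + m) 3 (path₃ (1 + x₁) (2 + x₂)) ≡
  pdinv m 3 (path₃ x₁ x₂) + (2 + indicator ((3 + m) * 1 <ᵇ 3 * (2 + x₂)))
pdinv-shift m x₁ x₂ (dyck₃ x₁≤x₂ row₁ row₂) = begin
  pdinv (3 + m) 3 b
    ≡⟨ cong₂ (λ r₁ r₂ → r₁ + (r₂ + 0)) (pdinv-row₁ (3 + m) (1 + x₁) (2 + x₂) (row-shift m x₁ 1 row₁))
                                        (count-applyUpTo cell′ (λ i → i) (2 + x₂)) ⟩
  suc x₁ + ((indicator (cell′ 0) + countBelow (suc x₂) (cell′ ∘ suc)) + 0)
    ≡⟨ cong (λ r → suc x₁ + ((indicator (cell′ 0) + r) + 0)) (countBelow-suc x₂ (cell′ ∘ suc)) ⟩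
  suc x₁ + ((indicator (cell′ 0) + (countBelow x₂ (cell′ ∘ suc) + indicator (cell′ (suc x₂)))) + 0)
    ≡⟨ cong₃ (λ c r l → suc x₁ + ((indicator c + (r + indicator l)) + 0)) corner (countBelow-cong x₂ middle) last ⟩
  suc x₁ + ((indicator corner? + (countBelow x₂ cell + 1)) + 0)
    ≡⟨ rearrange x₁ (indicator corner?) (countBelow x₂ cell) ⟩
  (x₁ + (countBelow x₂ cell + 0)) + (2 + indicator corner?)
    ≡⟨ cong₂ (λ r₁ r₂ → (r₁ + (r₂ + 0)) + (2 + indicator corner?)) (pdinv-row₁ m x₁ x₂ row₁)
                                                                    (count-applyUpTo cell (λ i → i) x₂) ⟨
  pdinv m 3 a + (2 + indicator corner?) ∎
  where
  open ≡-Reasoning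
  a b : List ℕ
  a = path₃ x₁ x₂
  b = path₃ (1 + x₁) (2 + x₂)
  cell cell′ : ℕ → Bool
  cell x = pdinvCell m 3 a x 2
  cell′ x = pdinvCell (3 + m) 3 b x 2
  corner? : Bool
  corner? = (3 + m) * 1 <ᵇ 3 * (2 + x₂)
  rearrange : ∀ x c r → suc x + ((c + (r + 1)) + 0) ≡ (x + (r + 0)) + (2 + c)
  rearrange = solve-∀
  arm-fits : ∀ arm → arm ≤ x₂ → suc arm * 3 ≤ (3 + m) * 2
  arm-fits arm arm≤x₂ =
    ℕ.+-mono-≤ (ℕ.m≤m+n 3 3) (ℕ.≤-trans (ℕ.*-monoˡ-≤ 3 arm≤x₂) (subst (_≤ m * 2) (ℕ.*-comm 3 x₂) row₂))
  corner : cell′ 0 ≡ corner?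
  corner = cong (_∧ corner?) (dec-true (suc x₂ * 3 ℕ.≤? (3 + m) * 2) (arm-fits x₂ ℕ.≤-refl))
  middle : ∀ i → i < x₂ → cell′ (suc i) ≡ cell i
  middle i i<x₂ rewrite ∸-pred i<x₂ =
    cellCondition-shift m (x₂ ∸ suc i) (i <ᵇ x₁) (ℕ.≤-trans (ℕ.*-monoʳ-≤ 3 (ℕ.m∸n≤m x₂ (suc i))) row₂)
  last : cell′ (suc x₂) ≡ true
  last rewrite ℕ.n∸n≡0 x₂ | dec-false (x₂ ℕ.<? x₁) (ℕ.≤⇒≯ x₁≤x₂) = refl

-- The bijection

dyck-shift : ∀ {m x₁ x₂} → Dyck₃ m x₁ x₂ → Dyck₃ (3 + m) (1 + x₁) (2 + x₂)
dyck-shift {m} {x₁} {x₂} (dyck₃ x₁≤x₂ row₁ row₂) =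
  dyck₃ (s≤s (ℕ.m≤n⇒m≤1+n x₁≤x₂)) (row-shift m x₁ 1 row₁) (row-shift m x₂ 2 row₂)

dyck-unshift : ∀ {m x₁ x₂} → Dyck₃ (3 + m) (1 + x₁) (2 + x₂) → x₁ ≤ x₂ → Dyck₃ m x₁ x₂
dyck-unshift {m} {x₁} {x₂} (dyck₃ _ row₁ row₂) x₁≤x₂ =
  dyck₃ x₁≤x₂ (row-unshift m x₁ 1 row₁) (row-unshift m x₂ 2 row₂)

pathWeight-shift : ∀ m₀ x₁ x₂ (i j : ℤ) → Dyck₃ (suc m₀) x₁ x₂ →
  pathWeight (3 + suc m₀) 3 (3 ∷ []) i j (path₃ (1 + x₁) (2 + x₂)) ≡
  pathWeight (suc m₀) 3 (1 ∷ 1 ∷ 1 ∷ []) i j (path₃ x₁ x₂)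
pathWeight-shift m₀ x₁ x₂ i j dyck = begin
  pathWeight (3 + m) 3 (3 ∷ []) i j b
    ≡⟨ pathWeight-3-reversed {3 + m} {i} {j} {b} order ranks′ (colIncreasing-shifted order x₁≤x₂) ⟩
  coeff (qtTerms (+ 1) (dinv (3 + m) 3 b (v ∷ u ∷ 0 ∷ [])) (area (3 + m) 3 b) (ret (3 + m) 3 b)) i j
    ≡⟨ cong₃ (λ e A r → coeff (qtTerms (+ 1) e A r) i j) dinv-b (area-shift m x₁ x₂) (ret-shift m x₁ x₂ dyck) ⟩
  coeff (qtTerms (+ 1) (+ pdinv m 3 a) (area m 3 a) (ret m 3 a)) i j
    ≡⟨ cong (λ e → coeff (qtTerms (+ 1) e (area m 3 a) (ret m 3 a)) i j) (sym dinv-a) ⟩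
  coeff (qtTerms (+ 1) (dinv m 3 a (0 ∷ u ∷ v ∷ [])) (area m 3 a) (ret m 3 a)) i j
    ≡⟨ sym (pathWeight-111-sorted {m} {i} {j} {a} order ranks sortedCol) ⟩
  pathWeight m 3 (1 ∷ 1 ∷ 1 ∷ []) i j a ∎
  where
  open ≡-Reasoning
  open ShiftedPath m₀ x₁ x₂ dyck
  open ShiftOrder shiftOrder
  dinv-a : dinv m 3 a (0 ∷ u ∷ v ∷ []) ≡ + pdinv m 3 a
  dinv-a = dinv-of-maximal m 3 a (0 ∷ u ∷ v ∷ []) (maxdinv-sorted {m} {a} order ranks sortedCol)
  maxdinv-b : maxdinv (3 + m) 3 b ≡ 2 + indicator ((3 + m) * 1 ℕ.<ᵇ 3 * (2 + x₂))
  maxdinv-b = begin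
    maxdinv (3 + m) 3 b
      ≡⟨ maxdinv-sorted {3 + m} {b} order ranks′ (colIncreasing-shifted-sorted order x₁≤x₂) ⟩
    tdinv (3 + m) 3 b (0 ∷ u ∷ v ∷ [])
      ≡⟨ tdinv-sorted {3 + m} {b} order ranks′ row₁-near-row₀′ (rowᵥ-near-rowᵤ′ order) ⟩
    2 + indicator (ltZ (rowRank (3 + m) 3 b 2) (rowRank (3 + m) 3 b 0 ℤ.+ + (3 + m)))
      ≡⟨ cong (λ c → 2 + indicator c) corner′ ⟩
    2 + indicator ((3 + m) * 1 ℕ.<ᵇ 3 * (2 + x₂)) ∎
  dinv-b : dinv (3 + m) 3 b (v ∷ u ∷ 0 ∷ []) ≡ + pdinv m 3 a
  dinv-b = dinv-of-minimal (3 + m) 3 b (v ∷ u ∷ 0 ∷ []) (pdinv m 3 a) (tdinv-reversed {3 + m} {b} order ranks′)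
    (trans (pdinv-shift m x₁ x₂ dyck) (cong (_+_ (pdinv m 3 a)) (sym maxdinv-b)))

dyckWeight-shift : ∀ m₀ i j x₁ x₂ →
  dyckWeight (3 + suc m₀) (3 ∷ []) i j (1 + x₁) (2 + x₂) ≡ dyckWeight (suc m₀) (1 ∷ 1 ∷ 1 ∷ []) i j x₁ x₂
dyckWeight-shift m₀ i j x₁ x₂ with dyck₃? (suc m₀) x₁ x₂
... | yes d = trans (dyckWeight-dyck (3 + suc m₀) (3 ∷ []) i j (1 + x₁) (2 + x₂) (dyck-shift d))
  (trans (pathWeight-shift m₀ x₁ x₂ i j d) (sym (dyckWeight-dyck (suc m₀) (1 ∷ 1 ∷ 1 ∷ []) i j x₁ x₂ d)))
... | no ¬d = trans (dyckWeight-vanishes (3 + suc m₀) (3 ∷ []) i j (1 + x₁) (2 + x₂) sameColumn)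
  (sym (dyckWeight-¬dyck (suc m₀) (1 ∷ 1 ∷ 1 ∷ []) i j x₁ x₂ ¬d))
  where
  -- Here b is Dyck only if x₁ = x₂ + 1, when rows 1 and 2 of b share a column.
  sameColumn : Dyck₃ (3 + suc m₀) (1 + x₁) (2 + x₂) →
    pathWeight (3 + suc m₀) 3 (3 ∷ []) i j (path₃ (1 + x₁) (2 + x₂)) ≡ + 0
  sameColumn d′ rewrite ℕ.≤-antisym (ℕ.s≤s⁻¹ (Dyck₃.monotone d′)) (ℕ.≰⇒> (¬d ∘ dyck-unshift d′)) =
    pathWeight-3-column₁₂ (3 + m₀) i j (2 + x₂)

dyckWeight-3-near-axis : ∀ M₀ i j x₁ x₂ → x₁ < 1 ⊎ x₂ < 2 → dyckWeight (suc M₀) (3 ∷ []) i j x₁ x₂ ≡ + 0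
dyckWeight-3-near-axis M₀ i j x₁ x₂ near = dyckWeight-vanishes (suc M₀) (3 ∷ []) i j x₁ x₂ (vanish x₁ x₂ near)
  where
  vanish : ∀ x₁ x₂ → x₁ < 1 ⊎ x₂ < 2 → Dyck₃ (suc M₀) x₁ x₂ →
    pathWeight (suc M₀) 3 (3 ∷ []) i j (path₃ x₁ x₂) ≡ + 0
  vanish zero           x₂             _                     _                     = pathWeight-3-column₀₁ M₀ i j x₂
  vanish (suc zero)     (suc zero)     _                     _                     = pathWeight-3-column₁₂ M₀ i j 1
  vanish (suc x₁)       zero           _                     (dyck₃ () _ _)
  vanish (suc (suc x₁)) (suc zero)     _                     (dyck₃ (s≤s ()) _ _)
  vanish (suc x₁)       x₂             (inj₁ (s≤s ()))       _
  vanish (suc x₁)       (suc (suc x₂)) (inj₂ (s≤s (s≤s ()))) _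

corollary2 : (m : ℕ) → 1 ≤ m → (i j : ℤ) →
    coeff (schurCoeffH m 3 (1 ∷ 1 ∷ 1 ∷ [])) i j ≡ coeff (schurCoeffH (m + 3) 3 (3 ∷ [])) i j
corollary2 (suc m₀) _ i j = begin
  coeff (schurCoeffH m 3 (1 ∷ 1 ∷ 1 ∷ [])) i j
    ≡⟨ coeff-schurCoeffH₃ m (1 ∷ 1 ∷ 1 ∷ []) i j ⟩
  sumBelow² (suc m) (suc m) (dyckWeight m (1 ∷ 1 ∷ 1 ∷ []) i j)
    ≡⟨ sumBelow²-dropBack 2 1 (suc m) (suc m) (dyckWeight-beyond m (1 ∷ 1 ∷ 1 ∷ []) i j) ⟨
  sumBelow² (3 + m) (2 + m) (dyckWeight m (1 ∷ 1 ∷ 1 ∷ []) i j)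
    ≡⟨ sumBelow²-cong (3 + m) (2 + m) (dyckWeight-shift m₀ i j) ⟨
  sumBelow² (3 + m) (2 + m) (λ x₁ x₂ → dyckWeight (3 + m) (3 ∷ []) i j (1 + x₁) (2 + x₂))
    ≡⟨ sumBelow²-dropFront 1 2 (3 + m) (2 + m) (dyckWeight-3-near-axis (2 + m) i j) ⟨
  sumBelow² (4 + m) (4 + m) (dyckWeight (3 + m) (3 ∷ []) i j)
    ≡⟨ coeff-schurCoeffH₃ (3 + m) (3 ∷ []) i j ⟨
  coeff (schurCoeffH (3 + m) 3 (3 ∷ [])) i j
    ≡⟨ cong (λ M → coeff (schurCoeffH M 3 (3 ∷ [])) i j) (ℕ.+-comm 3 m) ⟩
  coeff (schurCoeffH (m + 3) 3 (3 ∷ [])) i j ∎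
  where
  open ≡-Reasoning
  m : ℕ
  m = suc m₀
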